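{- Let $m>2$ be an integer, $q=2^m$, and let $c\in\mathbb{F}_q^*$ with $c\neq 1$. Then $$K(c^4+c^3)\equiv\begin{cases}1 \pmod 3 & \text{if } m \text{ is even and } \mathrm{Tr}(c)=0,\\ -1\pmod 3 & \text{if } m \text{ is even and } \mathrm{Tr}(c)=1,\\ 0 \pmod 3 & \text{if } m \text{ is odd.}\end{cases}$$
   Context: $\mathbb{F}_q$ is the finite field with $q=2^m$ elements, $\mathbb{F}_q^*=\mathbb{F}_q\setminus\{0\}$, and $\mathrm{Tr}:\mathbb{F}_q\to\mathbb{F}_2$ is the absolute trace $\mathrm{Tr}(x)=x+x^2+\dots+x^{2^{m-1}}$. $\chi(x)=(-1)^{\mathrm{Tr}(x)}$ is the canonical additive character of $\mathbb{F}_q$, and for $a\in\mathbb{F}_q$ the Kloosterman sum is $K(a)=\sum_{x\in\mathbb{F}_q^*}\chi(x+ax^{ -1})$. -}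

module Defs where

open import Level using (0ℓ)
open import Data.Nat as ℕ using (ℕ; zero; suc)
open import Data.Fin using (Fin)
open import Data.List using (List; foldr; map; allFin)
open import Data.Integer as ℤ using (ℤ)
open import Relation.Nullary using (¬_; Dec; yes; no)
open import Relation.Binary.PropositionalEquality using (_≡_; _≢_)
open import Relation.Binary.Definitions using (DecidableEquality)
open import Function.Bundles using (_↔_; Inverse)
open import Algebra.Structures using (IsCommutativeRing)

record FiniteField2^ (m : ℕ) : Set₁ where
  infixl 6 _+_
  infixl 7 _*_
  field
    Carrier : Set
    _+_ _*_ : Carrier → Carrier → Carrier
    -_ : Carrier → Carrier
    0# 1# : Carrier
    isCommutativeRing : IsCommutativeRing _≡_ _+_ _*_ -_ 0# 1#
    0≢1 : 0# ≢ 1#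
    _⁻¹ : Carrier → Carrier
    inverseʳ : ∀ x → x ≢ 0# → x * (x ⁻¹) ≡ 1#
    enum : Carrier ↔ Fin (2 ℕ.^ m)

  q : ℕ
  q = 2 ℕ.^ m

  elem : Fin q → Carrier
  elem = Inverse.from enum

  _≟_ : DecidableEquality Carrier
  x ≟ y with Data.Fin._≟_ (Inverse.to enum x) (Inverse.to enum y)
  ... | yes p = yes (subst-eq p)
    where
    open import Relation.Binary.PropositionalEquality using (cong; trans; sym)
    subst-eq : Inverse.to enum x ≡ Inverse.to enum y → x ≡ y
    subst-eq e = trans (sym (Inverse.strictlyInverseʳ enum x))
                   (trans (cong (Inverse.from enum) e) (Inverse.strictlyInverseʳ enum y))
  ... | no ¬p = no (λ e → ¬p (Relation.Binary.PropositionalEquality.cong (Inverse.to enum) e))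

  _^_ : Carrier → ℕ → Carrier
  x ^ zero = 1#
  x ^ suc n = x * (x ^ n)

  trAux : ℕ → Carrier → Carrier
  trAux zero x = 0#
  trAux (suc i) x = trAux i x + x ^ (2 ℕ.^ i)

  Tr : Carrier → Carrier
  Tr x = trAux m x

  -- canonical additive character χ(x) = (-1)^Tr(x)  (Tr(x) ∈ {0,1})
  χ : Carrier → ℤ
  χ x with Tr x ≟ 0#
  ... | yes _ = ℤ.+ 1
  ... | no _ = ℤ.- (ℤ.+ 1)

  -- Kloosterman sum K(a) = Σ_{x ∈ F_q^*} χ(x + a x^{-1})
  kTerm : Carrier → Carrier → ℤ
  kTerm a x with x ≟ 0#
  ... | yes _ = ℤ.+ 0
  ... | no _ = χ (x + a * (x ⁻¹))

  K : Carrier → ℤ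
  K a = foldr ℤ._+_ (ℤ.+ 0) (map (λ i → kTerm a (elem i)) (allFin q))

module Submission where

-- Let E be the curve Y² + XY + c²Y = X³ over 𝔽_q. Over X ≠ c² the substitution Y = (X + c²) t
-- turns E into t² + t = X³/(X + c²)², which has 1 + χ(X³/(X + c²)²) solutions; shifting X by c²
-- and using Tr(z² + z) = 0 turns the sum of these characters into χ(c) K(c⁴ + c³), so E has
-- q + χ(c) K(c⁴ + c³) affine points. On the other hand E has two points with X = 0, and the map
-- (X, Y) ↦ (c²Y/X², c⁴Y/X³) permutes the remaining points in orbits of length exactly 3 (a fixed
-- point would force c = 1). Hence q + χ(c) K(c⁴ + c³) ≡ 2 (mod 3), and the three cases follow from
-- q = 2^m ≡ 1 or 2 (mod 3) for m even or odd and χ(c) = (-1)^Tr(c).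

open import Defs
open import Data.Nat as ℕ using (ℕ; _<_; _%_)
open import Data.Integer as ℤ using (ℤ; +_; _-_)
open import Data.Integer.Divisibility using (_∣_)
open import Data.Product using (_×_)
open import Relation.Binary.PropositionalEquality using (_≡_; _≢_)

open import Level using (Level)
open import Data.Nat using (zero; suc)
import Data.Nat.Properties as ℕP
open import Data.Nat.DivMod using ([m+n]%n≡m%n)
open import Data.Fin as Fin using (Fin; zero; suc; toℕ; combine; _↑ˡ_; _↑ʳ_)
open import Data.Fin.Properties using (suc-injective; toℕ-injective; any?; *↔×; remQuot-combine)
open import Data.Integer using () renaming (_+_ to _+ℤ_; _*_ to _*ℤ_; -_ to -ℤ_)
import Data.Integer.Properties as ℤP
open import Data.Integer.Divisibility.Signed as Signed using (divides; ∣⇒∣ᵤ; ∣m∣n⇒∣m-n; ∣n⇒∣m*n; ∣m∣n⇒∣m+n; ∣m⇒∣m*n)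
open import Data.Integer.Tactic.RingSolver using (solve-∀)
open import Data.Bool using (Bool; true; false)
open import Data.Bool.Properties using (xor-∧-commutativeRing)
open import Data.Maybe using (Maybe; just; nothing)
open import Data.List using (List; []; _∷_; length; foldr; map; allFin; tabulate)
open import Data.List.Properties using (map-tabulate; length-tabulate)
open import Data.List.Relation.Unary.All using (All; []; _∷_; zipWith)
import Data.List.Relation.Unary.All.Properties as All
open import Data.List.Relation.Unary.AllPairs using ([]; _∷_)
open import Data.List.Relation.Unary.Unique.Propositional using (Unique)
import Data.List.Relation.Unary.Unique.Propositional.Properties as Unique
open import Data.Product using (_,_; proj₁; proj₂; ∃-syntax)
open import Data.Product.Function.NonDependent.Propositional using (_×-↔_)
open import Data.Sum using (_⊎_; inj₁; inj₂; [_,_])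
open import Data.Empty using (⊥-elim)
open import Function using (_∘_; _↔_; Inverse; mk↔ₛ′)
open import Function.Properties.Inverse using (↔-sym; ↔-trans)
open import Relation.Binary.Definitions using (tri<; tri≈; tri>)
open import Relation.Binary.PropositionalEquality using (refl; sym; trans; cong; cong₂; subst; module ≡-Reasoning)
open import Relation.Nullary using (Dec; yes; no; ¬_; ¬?)
open import Relation.Nullary.Decidable using (_×-dec_; decidable-stable)
open import Relation.Unary using (Decidable)
open import Algebra.Bundles using (CommutativeMonoid; CommutativeRing)
open import Algebra.Structures using (IsCommutativeRing)
import Algebra.Properties.CommutativeMonoid.Sum as MonoidSum
open import Algebra.Properties.Semiring.Sum ℤP.+-*-semiring using (*-distribˡ-sum)
import Algebra.Properties.Ring as RingProperties
import Algebra.Solver.Ring.AlmostCommutativeRing as ACR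

-- Finite sums

private
  variable
    ℓ : Level
    A : Set ℓ
    n : ℕ

module Reindex {c e} (M : CommutativeMonoid c e) where
  open CommutativeMonoid M using (Carrier; _≈_; reflexive) renaming (sym to ≈-sym; trans to ≈-trans)
  open MonoidSum M using (sum; sum-cong-≗; sum-permute)

  sum-reindex : (e : A ↔ Fin n) (φ : A ↔ A) (f : A → Carrier) →
                sum (λ i → f (Inverse.to φ (Inverse.from e i))) ≈ sum (λ i → f (Inverse.from e i))
  sum-reindex {n = n} e φ f = ≈-sym (≈-trans (sum-permute (f ∘ Inverse.from e) (↔-trans (↔-sym e) (↔-trans φ e)))
    (reflexive (sum-cong-≗ {n} λ i → cong f (Inverse.strictlyInverseʳ e (Inverse.to φ (Inverse.from e i))))))

open MonoidSum ℤP.+-0-commutativeMonoid using (sum; sum-cong-≗; ∑-distrib-+; ∑-comm; sum-replicate-zero)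
open MonoidSum ℕP.+-0-commutativeMonoid using () renaming (sum to sumℕ)
open Reindex ℤP.+-0-commutativeMonoid using (sum-reindex)

𝟙 : Dec A → ℤ
𝟙 (yes _) = + 1
𝟙 (no _) = + 0

𝟙-yes : (d : Dec A) → A → 𝟙 d ≡ + 1
𝟙-yes (yes _) _ = refl
𝟙-yes (no ¬a) a = ⊥-elim (¬a a)

𝟙-no : (d : Dec A) → ¬ A → 𝟙 d ≡ + 0
𝟙-no (yes a) ¬a = ⊥-elim (¬a a)
𝟙-no (no _) _ = refl

𝟙-cong : ∀ {b} {B : Set b} → (A → B) → (B → A) → (d : Dec A) (d′ : Dec B) → 𝟙 d ≡ 𝟙 d′
𝟙-cong f g (yes a) d′ = sym (𝟙-yes d′ (f a))
𝟙-cong f g (no ¬a) d′ = sym (𝟙-no d′ (¬a ∘ g))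

𝟙-⊎ : ∀ {b c} {B : Set b} {C : Set c} (d : Dec A) (d₁ : Dec B) (d₂ : Dec C) →
  (A → B ⊎ C) → (B ⊎ C → A) → ¬ (B × C) → 𝟙 d ≡ 𝟙 d₁ +ℤ 𝟙 d₂
𝟙-⊎ d (yes b) (yes c) _ _ ¬b×c = ⊥-elim (¬b×c (b , c))
𝟙-⊎ d (yes b) (no _) _ from _ = 𝟙-yes d (from (inj₁ b))
𝟙-⊎ d (no _) (yes c) _ from _ = 𝟙-yes d (from (inj₂ c))
𝟙-⊎ d (no ¬b) (no ¬c) to _ _ = 𝟙-no d (λ a → [ ¬b , ¬c ] (to a))

sum-ones : ∀ n → sum {n} (λ _ → + 1) ≡ + n
sum-ones zero = refl
sum-ones (suc n) = cong (_+ℤ_ (+ 1)) (sum-ones n)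

sum-δ : (j : Fin n) → sum (λ i → 𝟙 (i Fin.≟ j)) ≡ + 1
sum-δ {suc n} zero = cong (_+ℤ_ (+ 1)) (sum-replicate-zero n)
sum-δ {suc n} (suc j) = trans (ℤP.+-identityˡ _)
  (trans (sum-cong-≗ λ i → 𝟙-cong suc-injective (cong suc) (suc i Fin.≟ suc j) (i Fin.≟ j)) (sum-δ j))

sum-++ : ∀ m n (f : Fin (m ℕ.+ n) → ℤ) → sum f ≡ sum (λ i → f (i ↑ˡ n)) +ℤ sum (λ j → f (m ↑ʳ j))
sum-++ zero n f = sym (ℤP.+-identityˡ _)
sum-++ (suc m) n f = trans (cong (_+ℤ_ (f zero)) (sum-++ m n (f ∘ suc))) (sym (ℤP.+-assoc (f zero) _ _))

sum-combine : ∀ m n (f : Fin (m ℕ.* n) → ℤ) → sum f ≡ sum (λ i → sum (λ j → f (combine {m} {n} i j)))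
sum-combine zero n f = refl
sum-combine (suc m) n f = trans (sum-++ n (m ℕ.* n) f)
  (cong (_+ℤ_ (sum (λ j → f (j ↑ˡ (m ℕ.* n))))) (sum-combine m n (λ k → f (n ↑ʳ k))))

foldr-allFin≡sum : ∀ n (f : Fin n → ℤ) → foldr _+ℤ_ (+ 0) (map f (allFin n)) ≡ sum f
foldr-allFin≡sum n f = trans (cong (foldr _+ℤ_ (+ 0)) (map-tabulate (λ i → i) f)) (foldr-tabulate n f)
  where
  foldr-tabulate : ∀ n (f : Fin n → ℤ) → foldr _+ℤ_ (+ 0) (tabulate f) ≡ sum f
  foldr-tabulate zero f = refl
  foldr-tabulate (suc n) f = cong (_+ℤ_ (f zero)) (foldr-tabulate n (f ∘ suc))

sumℕ≡0⇒≡0 : (f : Fin n → ℕ) → sumℕ f ≡ 0 → ∀ i → f i ≡ 0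
sumℕ≡0⇒≡0 {suc n} f eq zero = ℕP.m+n≡0⇒m≡0 (f zero) eq
sumℕ≡0⇒≡0 {suc n} f eq (suc i) = sumℕ≡0⇒≡0 (f ∘ suc) (ℕP.m+n≡0⇒n≡0 (f zero) eq) i

sum-+≡+sumℕ : (f : Fin n → ℕ) → sum (λ i → + f i) ≡ + sumℕ f
sum-+≡+sumℕ {zero} f = refl
sum-+≡+sumℕ {suc n} f = cong (_+ℤ_ (+ f zero)) (sum-+≡+sumℕ (f ∘ suc))

-- Counting free orbits of an order-3 map

leastOf3 : ℕ → ℕ → ℕ → ℤ
leastOf3 a b c = 𝟙 ((a ℕ.<? b) ×-dec (a ℕ.<? c))

leastOf3-rotations : ℕ → ℕ → ℕ → ℤ
leastOf3-rotations a b c = leastOf3 a b c +ℤ leastOf3 b c a +ℤ leastOf3 c a b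

leastOf3-rotations-rotate : ∀ a b c → leastOf3-rotations a b c ≡ leastOf3-rotations b c a
leastOf3-rotations-rotate a b c = rotate (leastOf3 a b c) (leastOf3 b c a) (leastOf3 c a b)
  where
  rotate : ∀ x y z → x +ℤ y +ℤ z ≡ y +ℤ z +ℤ x
  rotate = solve-∀

leastOf3-rotations-first : ∀ {a b c} → a ℕ.< b → a ℕ.< c → leastOf3-rotations a b c ≡ + 1
leastOf3-rotations-first {a} {b} {c} a<b a<c
  rewrite 𝟙-yes ((a ℕ.<? b) ×-dec (a ℕ.<? c)) (a<b , a<c)
        | 𝟙-no ((b ℕ.<? c) ×-dec (b ℕ.<? a)) (ℕP.<-asym a<b ∘ proj₂)
        | 𝟙-no ((c ℕ.<? a) ×-dec (c ℕ.<? b)) (ℕP.<-asym a<c ∘ proj₁) = refl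

least-of-three : ∀ {a b c} → a ≢ b → b ≢ c → c ≢ a →
  (a ℕ.< b × a ℕ.< c) ⊎ (b ℕ.< c × b ℕ.< a) ⊎ (c ℕ.< a × c ℕ.< b)
least-of-three {a} {b} {c} a≢b b≢c c≢a with ℕP.<-cmp a b | ℕP.<-cmp b c | ℕP.<-cmp c a
... | tri≈ _ a≡b _ | _ | _ = ⊥-elim (a≢b a≡b)
... | _ | tri≈ _ b≡c _ | _ = ⊥-elim (b≢c b≡c)
... | _ | _ | tri≈ _ c≡a _ = ⊥-elim (c≢a c≡a)
... | tri< a<b _ _ | _ | tri> _ _ a<c = inj₁ (a<b , a<c)
... | tri> _ _ b<a | tri< b<c _ _ | _ = inj₂ (inj₁ (b<c , b<a))
... | _ | tri> _ _ c<b | tri< c<a _ _ = inj₂ (inj₂ (c<a , c<b))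
... | tri< a<b _ _ | tri< b<c _ _ | tri< c<a _ _ = ⊥-elim (ℕP.<-irrefl refl (ℕP.<-trans a<b (ℕP.<-trans b<c c<a)))
... | tri> _ _ b<a | tri> _ _ c<b | tri> _ _ a<c = ⊥-elim (ℕP.<-irrefl refl (ℕP.<-trans a<c (ℕP.<-trans c<b b<a)))

leastOf3-rotations-distinct : ∀ {a b c} → a ≢ b → b ≢ c → c ≢ a → leastOf3-rotations a b c ≡ + 1
leastOf3-rotations-distinct {a} {b} {c} a≢b b≢c c≢a with least-of-three a≢b b≢c c≢a
... | inj₁ (a<b , a<c) = leastOf3-rotations-first a<b a<c
... | inj₂ (inj₁ (b<c , b<a)) = trans (leastOf3-rotations-rotate a b c) (leastOf3-rotations-first b<c b<a)
... | inj₂ (inj₂ (c<a , c<b)) = trans (leastOf3-rotations-rotate a b c)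
  (trans (leastOf3-rotations-rotate b c a) (leastOf3-rotations-first c<a c<b))

-- Exactly one point of each orbit {x, σ x, σ² x} has the least index, so g counts the orbits,
-- and shifting along σ counts each of them three times.
order-3-free⇒3∣count : (e : A ↔ Fin n) (σ : A → A) {P : A → Set} (P? : Decidable P) →
  (∀ x → σ (σ (σ x)) ≡ x) → (∀ {x} → P x → P (σ x)) → (∀ {x} → P x → σ x ≢ x) →
  + 3 Signed.∣ sum (λ i → 𝟙 (P? (Inverse.from e i)))
order-3-free⇒3∣count e σ {P} P? σ³≡id σ-pres σ-free =
  divides (sum (g ∘ Inverse.from e)) count≡3·Σg
  where
  open ≡-Reasoning
  rank : _ → ℕ
  rank = toℕ ∘ Inverse.to e

  rank-injective : ∀ {x y} → rank x ≡ rank y → x ≡ y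
  rank-injective {x} {y} eq = trans (sym (Inverse.strictlyInverseʳ e x))
    (trans (cong (Inverse.from e) (toℕ-injective eq)) (Inverse.strictlyInverseʳ e y))

  least : _ → ℤ
  least x = leastOf3 (rank x) (rank (σ x)) (rank (σ (σ x)))

  g : _ → ℤ
  g x = 𝟙 (P? x) *ℤ least x

  g-P : ∀ {x} → P x → g x ≡ least x
  g-P {x} p = trans (cong (_*ℤ least x) (𝟙-yes (P? x) p)) (ℤP.*-identityˡ (least x))

  g-¬P : ∀ {x} → ¬ P x → g x ≡ + 0
  g-¬P {x} ¬p = cong (_*ℤ least x) (𝟙-no (P? x) ¬p)

  P-back : ∀ {x} → P (σ x) → P x
  P-back {x} p = subst P (σ³≡id x) (σ-pres (σ-pres p))

  orbit-sum : ∀ x → 𝟙 (P? x) ≡ g x +ℤ g (σ x) +ℤ g (σ (σ x))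
  orbit-sum x = by-cases (P? x)
    where
    by-cases : Dec (P x) → 𝟙 (P? x) ≡ g x +ℤ g (σ x) +ℤ g (σ (σ x))
    by-cases (no ¬p) = trans (𝟙-no (P? x) ¬p)
      (sym (cong₂ _+ℤ_ (cong₂ _+ℤ_ (g-¬P ¬p) (g-¬P (¬p ∘ P-back))) (g-¬P (¬p ∘ P-back ∘ P-back))))
    by-cases (yes p) = trans (𝟙-yes (P? x) p) (sym (begin
      g x +ℤ g (σ x) +ℤ g (σ (σ x))
        ≡⟨ cong₂ _+ℤ_ (cong₂ _+ℤ_ (g-P p) (g-P (σ-pres p))) (g-P (σ-pres (σ-pres p))) ⟩
      least x +ℤ least (σ x) +ℤ least (σ (σ x))
        ≡⟨ cong (λ y → least x +ℤ leastOf3 (rank (σ x)) (rank (σ (σ x))) (rank y)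
                              +ℤ leastOf3 (rank (σ (σ x))) (rank y) (rank (σ y))) (σ³≡id x) ⟩
      leastOf3-rotations (rank x) (rank (σ x)) (rank (σ (σ x)))
        ≡⟨ leastOf3-rotations-distinct
             (λ eq → free (sym (rank-injective eq)))
             (λ eq → free (sym (trans (sym (σ³≡id x)) (trans (cong (σ ∘ σ) (rank-injective eq)) (cong σ (σ³≡id x))))))
             (λ eq → free (sym (trans (sym (σ³≡id x)) (cong σ (rank-injective eq))))) ⟩
      + 1 ∎))
      where
      free : σ x ≢ x
      free = σ-free p

  σ↔ σσ↔ : _ ↔ _
  σ↔ = mk↔ₛ′ σ (σ ∘ σ) σ³≡id σ³≡id
  σσ↔ = mk↔ₛ′ (σ ∘ σ) σ σ³≡id σ³≡id

  count≡3·Σg : sum (λ i → 𝟙 (P? (Inverse.from e i))) ≡ sum (g ∘ Inverse.from e) *ℤ + 3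
  count≡3·Σg = begin
    sum (λ i → 𝟙 (P? (Inverse.from e i)))
      ≡⟨ sum-cong-≗ (orbit-sum ∘ Inverse.from e) ⟩
    sum (λ i → g (x i) +ℤ g (σ (x i)) +ℤ g (σ (σ (x i))))
      ≡⟨ trans (∑-distrib-+ (λ i → g (x i) +ℤ g (σ (x i))) (λ i → g (σ (σ (x i)))))
               (cong (_+ℤ sum (λ i → g (σ (σ (x i))))) (∑-distrib-+ (g ∘ x) (λ i → g (σ (x i))))) ⟩
    sum (g ∘ x) +ℤ sum (λ i → g (σ (x i))) +ℤ sum (λ i → g (σ (σ (x i))))
      ≡⟨ cong₂ (λ u v → sum (g ∘ x) +ℤ u +ℤ v) (sum-reindex e σ↔ g) (sum-reindex e σσ↔ g) ⟩
    sum (g ∘ x) +ℤ sum (g ∘ x) +ℤ sum (g ∘ x)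
      ≡⟨ thrice (sum (g ∘ x)) ⟩
    sum (g ∘ x) *ℤ + 3 ∎
    where
    x = Inverse.from e
    thrice : ∀ s → s +ℤ s +ℤ s ≡ s *ℤ + 3
    thrice = solve-∀

order-3-free-on⇒3∣count : (e : A ↔ Fin n) (σ : A → A) {P : A → Set} (P? : Decidable P) →
  (∀ {x} → P x → σ (σ (σ x)) ≡ x) → (∀ {x} → P x → P (σ x)) → (∀ {x} → P x → σ x ≢ x) →
  + 3 Signed.∣ sum (λ i → 𝟙 (P? (Inverse.from e i)))
order-3-free-on⇒3∣count e σ {P} P? σ³≡id σ-pres σ-free =
  order-3-free⇒3∣count e σ′ P? σ′³≡id (λ p → subst P (sym (σ′-P p)) (σ-pres p)) (λ p → σ-free p ∘ trans (sym (σ′-P p)))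
  where
  σ′ : _ → _
  σ′ x with P? x
  ... | yes _ = σ x
  ... | no _ = x

  σ′-P : ∀ {x} → P x → σ′ x ≡ σ x
  σ′-P {x} p with P? x
  ... | yes _ = refl
  ... | no ¬p = ⊥-elim (¬p p)

  σ′-¬P : ∀ {x} → ¬ P x → σ′ x ≡ x
  σ′-¬P {x} ¬p with P? x
  ... | yes p = ⊥-elim (¬p p)
  ... | no _ = refl

  σ′³≡id : ∀ x → σ′ (σ′ (σ′ x)) ≡ x
  σ′³≡id x with P? x
  ... | yes p = trans (cong σ′ (σ′-P (σ-pres p))) (trans (σ′-P (σ-pres (σ-pres p))) (σ³≡id p))
  ... | no ¬p = trans (cong σ′ (σ′-¬P ¬p)) (σ′-¬P ¬p)

-- Finite fields of characteristic 2

2^k-even : ∀ k → k ≢ 0 → ∃[ r ] 2 ℕ.^ k ≡ r ℕ.+ r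
2^k-even zero k≢0 = ⊥-elim (k≢0 refl)
2^k-even (suc k) _ = 2 ℕ.^ k , cong (2 ℕ.^ k ℕ.+_) (ℕP.+-identityʳ (2 ℕ.^ k))

module Field {m : ℕ} (F : FiniteField2^ m) where
  open FiniteField2^ F public
  open IsCommutativeRing isCommutativeRing public
    using (+-assoc; +-comm; +-identityˡ; +-identityʳ; *-assoc; *-comm; *-identityˡ; *-identityʳ; zeroˡ; zeroʳ; -‿inverseˡ; -‿inverseʳ)

  ring : CommutativeRing _ _
  ring = record { isCommutativeRing = isCommutativeRing }

  open RingProperties (CommutativeRing.ring ring) using (-1*x≈-x; -‿involutive; -0#≈0#)
  open import Algebra.Properties.CommutativeSemigroup (CommutativeRing.*-commutativeSemigroup ring) using (interchange)

  1≢0 : 1# ≢ 0#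
  1≢0 = 0≢1 ∘ sym

  inverseˡ : ∀ x → x ≢ 0# → x ⁻¹ * x ≡ 1#
  inverseˡ x x≢0 = trans (*-comm _ _) (inverseʳ x x≢0)

  *-cancelˡ : ∀ {x y z} → x ≢ 0# → x * y ≡ x * z → y ≡ z
  *-cancelˡ {x} {y} {z} x≢0 eq = begin
    y                ≡⟨ sym (*-identityˡ y) ⟩
    1# * y           ≡⟨ cong (_* y) (sym (inverseˡ x x≢0)) ⟩
    (x ⁻¹ * x) * y   ≡⟨ *-assoc _ _ _ ⟩
    x ⁻¹ * (x * y)   ≡⟨ cong (x ⁻¹ *_) eq ⟩
    x ⁻¹ * (x * z)   ≡⟨ sym (*-assoc _ _ _) ⟩
    (x ⁻¹ * x) * z   ≡⟨ cong (_* z) (inverseˡ x x≢0) ⟩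
    1# * z           ≡⟨ *-identityˡ z ⟩
    z                ∎
    where open ≡-Reasoning

  x*y≡0⇒y≡0 : ∀ {x y} → x ≢ 0# → x * y ≡ 0# → y ≡ 0#
  x*y≡0⇒y≡0 {x} x≢0 eq = *-cancelˡ x≢0 (trans eq (sym (zeroʳ x)))

  x*y≢0 : ∀ {x y} → x ≢ 0# → y ≢ 0# → x * y ≢ 0#
  x*y≢0 x≢0 y≢0 = y≢0 ∘ x*y≡0⇒y≡0 x≢0

  x*x≡0⇒x≡0 : ∀ {x} → x * x ≡ 0# → x ≡ 0#
  x*x≡0⇒x≡0 {x} eq with x ≟ 0#
  ... | yes x≡0 = x≡0
  ... | no x≢0 = x*y≡0⇒y≡0 x≢0 eq

  ⁻¹≢0 : ∀ {x} → x ≢ 0# → x ⁻¹ ≢ 0#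
  ⁻¹≢0 {x} x≢0 x⁻¹≡0 = 0≢1 (trans (sym (zeroʳ x)) (trans (cong (x *_) (sym x⁻¹≡0)) (inverseʳ x x≢0)))

  *≡⇒≡*⁻¹ : ∀ {x y z} → x ≢ 0# → x * y ≡ z → y ≡ z * x ⁻¹
  *≡⇒≡*⁻¹ {x} {y} {z} x≢0 eq = *-cancelˡ x≢0 (begin
    x * y            ≡⟨ eq ⟩
    z                ≡⟨ sym (*-identityʳ z) ⟩
    z * 1#           ≡⟨ cong (z *_) (sym (inverseʳ x x≢0)) ⟩
    z * (x * x ⁻¹)   ≡⟨ sym (*-assoc z x _) ⟩
    z * x * x ⁻¹     ≡⟨ cong (_* x ⁻¹) (*-comm z x) ⟩
    x * z * x ⁻¹     ≡⟨ *-assoc x z _ ⟩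
    x * (z * x ⁻¹)   ∎)
    where open ≡-Reasoning

  ≡*⁻¹⇒*≡ : ∀ {x y z} → x ≢ 0# → y ≡ z * x ⁻¹ → x * y ≡ z
  ≡*⁻¹⇒*≡ {x} {y} {z} x≢0 refl = begin
    x * (z * x ⁻¹)   ≡⟨ sym (*-assoc x z _) ⟩
    x * z * x ⁻¹     ≡⟨ cong (_* x ⁻¹) (*-comm x z) ⟩
    z * x * x ⁻¹     ≡⟨ *-assoc z x _ ⟩
    z * (x * x ⁻¹)   ≡⟨ cong (z *_) (inverseʳ x x≢0) ⟩
    z * 1#           ≡⟨ *-identityʳ z ⟩
    z                ∎
    where open ≡-Reasoning

  ⁻¹-unique : ∀ {x y} → x * y ≡ 1# → y ≡ x ⁻¹
  ⁻¹-unique {x} {y} eq = trans (*≡⇒≡*⁻¹ x≢0 eq) (*-identityˡ _)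
    where
    x≢0 : x ≢ 0#
    x≢0 x≡0 = 0≢1 (trans (sym (zeroˡ y)) (trans (cong (_* y) (sym x≡0)) eq))

  ⁻¹-* : ∀ {x y} → x ≢ 0# → y ≢ 0# → (x * y) ⁻¹ ≡ x ⁻¹ * y ⁻¹
  ⁻¹-* {x} {y} x≢0 y≢0 = sym (⁻¹-unique (begin
    x * y * (x ⁻¹ * y ⁻¹)      ≡⟨ interchange x y (x ⁻¹) (y ⁻¹) ⟩
    x * x ⁻¹ * (y * y ⁻¹)      ≡⟨ cong₂ _*_ (inverseʳ x x≢0) (inverseʳ y y≢0) ⟩
    1# * 1#                    ≡⟨ *-identityˡ 1# ⟩
    1#                         ∎))
    where
    open ≡-Reasoning

  y*[x*x⁻¹]≡y : ∀ {x} → x ≢ 0# → ∀ y → y * (x * x ⁻¹) ≡ y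
  y*[x*x⁻¹]≡y {x} x≢0 y = trans (cong (y *_) (inverseʳ x x≢0)) (*-identityʳ y)

  module ∏ = MonoidSum (CommutativeRing.*-commutativeMonoid ring)
  open Reindex (CommutativeRing.*-commutativeMonoid ring) using () renaming (sum-reindex to ∏-reindex)

  index : Carrier → Fin q
  index = Inverse.to enum

  elem-index : ∀ x → elem (index x) ≡ x
  elem-index = Inverse.strictlyInverseʳ enum

  index-elem : ∀ i → index (elem i) ≡ i
  index-elem = Inverse.strictlyInverseˡ enum

  +-↔ : Carrier → Carrier ↔ Carrier
  +-↔ a = mk↔ₛ′ (_+ a) (_+ - a) (cancel (- a) a (-‿inverseˡ a)) (cancel a (- a) (-‿inverseʳ a))
    where
    cancel : ∀ a b → a + b ≡ 0# → ∀ x → x + a + b ≡ x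
    cancel a b a+b≡0 x = trans (+-assoc x a b) (trans (cong (_+_ x) a+b≡0) (+-identityʳ x))

  *-↔ : ∀ {a} → a ≢ 0# → Carrier ↔ Carrier
  *-↔ {a} a≢0 = mk↔ₛ′ (a *_) (a ⁻¹ *_) (cancel (inverseʳ a a≢0)) (cancel (inverseˡ a a≢0))
    where
    cancel : ∀ {a b} → a * b ≡ 1# → ∀ x → a * (b * x) ≡ x
    cancel {a} {b} a*b≡1 x = trans (sym (*-assoc a b x)) (trans (cong (_* x) a*b≡1) (*-identityˡ x))

  Σ : (Carrier → ℤ) → ℤ
  Σ f = sum (f ∘ elem)

  Σ-cong : ∀ {f g} → (∀ x → f x ≡ g x) → Σ f ≡ Σ g
  Σ-cong f≗g = sum-cong-≗ (f≗g ∘ elem)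

  Σ-+ : ∀ f g → Σ (λ x → f x +ℤ g x) ≡ Σ f +ℤ Σ g
  Σ-+ f g = ∑-distrib-+ (f ∘ elem) (g ∘ elem)

  Σ-scale : ∀ k f → Σ (λ x → k *ℤ f x) ≡ k *ℤ Σ f
  Σ-scale k f = sym (*-distribˡ-sum k (f ∘ elem))

  Σ-neg : ∀ f → Σ (λ x → -ℤ f x) ≡ -ℤ Σ f
  Σ-neg f = trans (Σ-cong (λ x → sym (ℤP.-1*i≡-i (f x)))) (trans (Σ-scale (-ℤ + 1) f) (ℤP.-1*i≡-i (Σ f)))

  Σ-reindex : (φ : Carrier ↔ Carrier) (f : Carrier → ℤ) → Σ (f ∘ Inverse.to φ) ≡ Σ f
  Σ-reindex = sum-reindex enum

  Σ-ones : Σ (λ _ → + 1) ≡ + q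
  Σ-ones = sum-ones q

  Σ-δ : ∀ y → Σ (λ x → 𝟙 (x ≟ y)) ≡ + 1
  Σ-δ y = trans (sum-cong-≗ λ i → 𝟙-cong (λ eq → trans (sym (index-elem i)) (cong index eq))
                                         (λ eq → trans (cong elem eq) (elem-index y))
                                         (elem i ≟ y) (i Fin.≟ index y))
                (sum-δ (index y))

  Σ-δ′ : ∀ y → Σ (λ x → 𝟙 (y ≟ x)) ≡ + 1
  Σ-δ′ y = trans (Σ-cong (λ x → 𝟙-cong sym sym (y ≟ x) (x ≟ y))) (Σ-δ y)

  Σ-pick : ∀ y (f : Carrier → ℤ) → Σ (λ x → 𝟙 (x ≟ y) *ℤ f x) ≡ f y
  Σ-pick y f = begin
    Σ (λ x → 𝟙 (x ≟ y) *ℤ f x)   ≡⟨ Σ-cong (λ x → pick x (x ≟ y)) ⟩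
    Σ (λ x → f y *ℤ 𝟙 (x ≟ y))   ≡⟨ Σ-scale (f y) (λ x → 𝟙 (x ≟ y)) ⟩
    f y *ℤ Σ (λ x → 𝟙 (x ≟ y))   ≡⟨ cong (f y *ℤ_) (Σ-δ y) ⟩
    f y *ℤ + 1                   ≡⟨ ℤP.*-identityʳ (f y) ⟩
    f y                          ∎
    where
    open ≡-Reasoning
    pick : ∀ x (d : Dec (x ≡ y)) → 𝟙 d *ℤ f x ≡ f y *ℤ 𝟙 d
    pick x (yes refl) = ℤP.*-comm (+ 1) (f x)
    pick x (no _) = sym (ℤP.*-zeroʳ (f y))

  pairs : (Carrier × Carrier) ↔ Fin (q ℕ.* q)
  pairs = ↔-trans (enum ×-↔ enum) (↔-sym *↔×)

  sum-pairs : (f : Carrier × Carrier → ℤ) → sum (λ k → f (Inverse.from pairs k)) ≡ Σ (λ X → Σ (λ Y → f (X , Y)))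
  sum-pairs f = trans (sum-combine q q (λ k → f (Inverse.from pairs k)))
    (sum-cong-≗ {q} λ i → sum-cong-≗ {q} λ j → cong (λ p → f (elem (proj₁ p) , elem (proj₂ p))) (remQuot-combine i j))

  toUnit : Carrier → Carrier
  toUnit y with y ≟ 0#
  ... | yes _ = 1#
  ... | no _ = y

  scaleOnSupport : Carrier → Carrier → Carrier
  scaleOnSupport x y with y ≟ 0#
  ... | yes _ = 1#
  ... | no _ = x

  toUnit≢0 : ∀ y → toUnit y ≢ 0#
  toUnit≢0 y with y ≟ 0#
  ... | yes _ = 1≢0
  ... | no y≢0 = y≢0

  toUnit-* : ∀ {x} → x ≢ 0# → ∀ y → toUnit (x * y) ≡ scaleOnSupport x y * toUnit y
  toUnit-* {x} x≢0 y with y ≟ 0# | (x * y) ≟ 0#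
  ... | yes _ | yes _ = sym (*-identityˡ 1#)
  ... | yes refl | no x*0≢0 = ⊥-elim (x*0≢0 (zeroʳ x))
  ... | no y≢0 | yes x*y≡0 = ⊥-elim (x*y≢0 x≢0 y≢0 x*y≡0)
  ... | no _ | no _ = refl

  nonzeroCount : ∀ {n} → (Fin n → Carrier) → ℕ
  nonzeroCount {zero} e = 0
  nonzeroCount {suc n} e with e zero ≟ 0#
  ... | yes _ = nonzeroCount (e ∘ suc)
  ... | no _ = suc (nonzeroCount (e ∘ suc))

  ∏-scaleOnSupport : ∀ x {n} (e : Fin n → Carrier) → ∏.sum (scaleOnSupport x ∘ e) ≡ x ^ nonzeroCount e
  ∏-scaleOnSupport x {zero} e = refl
  ∏-scaleOnSupport x {suc n} e with e zero ≟ 0#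
  ... | yes _ = trans (*-identityˡ _) (∏-scaleOnSupport x (e ∘ suc))
  ... | no _ = cong (x *_) (∏-scaleOnSupport x (e ∘ suc))

  zeroCount : ∀ {n} → (Fin n → Carrier) → ℤ
  zeroCount e = sum (λ i → 𝟙 (e i ≟ 0#))

  nonzeroCount+zeroCount : ∀ {n} (e : Fin n → Carrier) → + nonzeroCount e +ℤ zeroCount e ≡ + n
  nonzeroCount+zeroCount {zero} e = refl
  nonzeroCount+zeroCount {suc n} e with e zero ≟ 0#
  ... | yes _ = trans (shuffle (+ nonzeroCount (e ∘ suc)) (zeroCount (e ∘ suc))) (cong (_+ℤ_ (+ 1)) (nonzeroCount+zeroCount (e ∘ suc)))
    where
    shuffle : ∀ a s → a +ℤ (+ 1 +ℤ s) ≡ + 1 +ℤ (a +ℤ s)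
    shuffle = solve-∀
  ... | no _ = trans (shuffle (+ nonzeroCount (e ∘ suc)) (zeroCount (e ∘ suc))) (cong (_+ℤ_ (+ 1)) (nonzeroCount+zeroCount (e ∘ suc)))
    where
    shuffle : ∀ a s → (+ 1 +ℤ a) +ℤ (+ 0 +ℤ s) ≡ + 1 +ℤ (a +ℤ s)
    shuffle = solve-∀

  nonzeroCount-elem : nonzeroCount elem ℕ.+ 1 ≡ q
  nonzeroCount-elem = ℤP.+-injective (begin
    + (nonzeroCount elem ℕ.+ 1)             ≡⟨ ℤP.pos-+ (nonzeroCount elem) 1 ⟩
    + nonzeroCount elem +ℤ + 1              ≡⟨ cong (_+ℤ_ (+ nonzeroCount elem)) (sym (Σ-δ 0#)) ⟩
    + nonzeroCount elem +ℤ Σ (λ x → 𝟙 (x ≟ 0#)) ≡⟨ nonzeroCount+zeroCount elem ⟩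
    + q                                     ∎)
    where open ≡-Reasoning

  ∏≢0 : ∀ {n} (e : Fin n → Carrier) → (∀ i → e i ≢ 0#) → ∏.sum e ≢ 0#
  ∏≢0 {zero} e _ = 1≢0
  ∏≢0 {suc n} e e≢0 = x*y≢0 (e≢0 zero) (∏≢0 (e ∘ suc) (e≢0 ∘ suc))

  -- Multiplication by x permutes 𝔽_q and multiplies the product of all units by x^(q-1).
  x^[q-1]≡1 : ∀ {x} → x ≢ 0# → x ^ nonzeroCount elem ≡ 1#
  x^[q-1]≡1 {x} x≢0 = *-cancelˡ (∏≢0 (toUnit ∘ elem) (toUnit≢0 ∘ elem)) (begin
    P * x ^ nonzeroCount elem                  ≡⟨ *-comm P _ ⟩
    x ^ nonzeroCount elem * P                  ≡⟨ cong (_* P) (sym (∏-scaleOnSupport x elem)) ⟩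
    ∏.sum (scaleOnSupport x ∘ elem) * P         ≡⟨ sym (∏.∑-distrib-+ (scaleOnSupport x ∘ elem) (toUnit ∘ elem)) ⟩
    ∏.sum (λ i → scaleOnSupport x (elem i) * toUnit (elem i)) ≡⟨ ∏.sum-cong-≗ (sym ∘ toUnit-* x≢0 ∘ elem) ⟩
    ∏.sum (λ i → toUnit (x * elem i))          ≡⟨ ∏-reindex enum (*-↔ x≢0) toUnit ⟩
    P                                          ≡⟨ sym (*-identityʳ P) ⟩
    P * 1#                                     ∎)
    where
    open ≡-Reasoning
    P = ∏.sum (toUnit ∘ elem)

  ^-+ : ∀ x a b → x ^ (a ℕ.+ b) ≡ x ^ a * x ^ b
  ^-+ x zero b = sym (*-identityˡ _)
  ^-+ x (suc a) b = trans (cong (x *_) (^-+ x a b)) (sym (*-assoc _ _ _))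

  x^q≡x : ∀ x → x ^ q ≡ x
  x^q≡x x = begin
    x ^ q                              ≡⟨ cong (x ^_) (sym nonzeroCount-elem) ⟩
    x ^ (nonzeroCount elem ℕ.+ 1)      ≡⟨ ^-+ x (nonzeroCount elem) 1 ⟩
    x ^ nonzeroCount elem * (x * 1#)   ≡⟨ cong (x ^ nonzeroCount elem *_) (*-identityʳ x) ⟩
    x ^ nonzeroCount elem * x          ≡⟨ by-cases (x ≟ 0#) ⟩
    x                                  ∎
    where
    open ≡-Reasoning
    by-cases : Dec (x ≡ 0#) → x ^ nonzeroCount elem * x ≡ x
    by-cases (yes refl) = zeroʳ _
    by-cases (no x≢0) = trans (cong (_* x) (x^[q-1]≡1 x≢0)) (*-identityˡ x)

  ^-distrib-* : ∀ x y n → (x * y) ^ n ≡ x ^ n * y ^ n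
  ^-distrib-* x y zero = sym (*-identityˡ 1#)
  ^-distrib-* x y (suc n) = trans (cong (_*_ (x * y)) (^-distrib-* x y n)) (interchange x y (x ^ n) (y ^ n))

  1^n≡1 : ∀ n → 1# ^ n ≡ 1#
  1^n≡1 zero = refl
  1^n≡1 (suc n) = trans (*-identityˡ _) (1^n≡1 n)

  m≢0 : m ≢ 0
  m≢0 refl = 0≢1 (trans (sym (elem-index 0#)) (trans (cong elem (Fin1-unique (index 0#) (index 1#))) (elem-index 1#)))
    where
    Fin1-unique : (i j : Fin 1) → i ≡ j
    Fin1-unique zero zero = refl

  -1≡1 : - 1# ≡ 1#
  -1≡1 with 2^k-even m m≢0
  ... | r , q≡r+r = begin
    - 1#                      ≡⟨ sym (x^q≡x (- 1#)) ⟩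
    (- 1#) ^ q                ≡⟨ cong ((- 1#) ^_) q≡r+r ⟩
    (- 1#) ^ (r ℕ.+ r)        ≡⟨ ^-+ (- 1#) r r ⟩
    (- 1#) ^ r * (- 1#) ^ r   ≡⟨ sym (^-distrib-* (- 1#) (- 1#) r) ⟩
    (- 1# * - 1#) ^ r         ≡⟨ cong (_^ r) (trans (-1*x≈-x (- 1#)) (-‿involutive 1#)) ⟩
    1# ^ r                    ≡⟨ 1^n≡1 r ⟩
    1#                        ∎
    where open ≡-Reasoning

  1+1≡0 : 1# + 1# ≡ 0#
  1+1≡0 = trans (cong (_+_ 1#) (sym -1≡1)) (-‿inverseʳ 1#)

  -- Characteristic-2 identities are normalised by the ring solver with coefficients in 𝔽₂.
  𝔽₂ : CommutativeRing _ _
  𝔽₂ = xor-∧-commutativeRing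

  ⟦_⟧₂ : Bool → Carrier
  ⟦ true ⟧₂ = 1#
  ⟦ false ⟧₂ = 0#

  𝔽₂-morphism : CommutativeRing.rawRing 𝔽₂ ACR.-Raw-AlmostCommutative⟶ ACR.fromCommutativeRing ring
  𝔽₂-morphism = record
    { ⟦_⟧ = ⟦_⟧₂
    ; +-homo = λ { false y → sym (+-identityˡ ⟦ y ⟧₂) ; true false → sym (+-identityʳ 1#) ; true true → sym 1+1≡0 }
    ; *-homo = λ { false y → sym (zeroˡ ⟦ y ⟧₂) ; true y → sym (*-identityˡ ⟦ y ⟧₂) }
    ; -‿homo = λ { false → sym -0#≈0# ; true → sym -1≡1 }
    ; 0-homo = refl
    ; 1-homo = refl
    }

  𝔽₂-≟ : (a b : Bool) → Maybe (⟦ a ⟧₂ ≡ ⟦ b ⟧₂)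
  𝔽₂-≟ false false = just refl
  𝔽₂-≟ true true = just refl
  𝔽₂-≟ _ _ = nothing

  open import Algebra.Solver.Ring (CommutativeRing.rawRing 𝔽₂) (ACR.fromCommutativeRing ring) 𝔽₂-morphism 𝔽₂-≟
    public using (solve; _:=_; _:+_; _:*_; con)

  x+x≡0 : ∀ x → x + x ≡ 0#
  x+x≡0 = solve 1 (λ x → x :+ x := con false) refl

  x+y+y≡x : ∀ x y → x + y + y ≡ x
  x+y+y≡x = solve 2 (λ x y → x :+ y :+ y := x) refl

  x+y≡0⇒x≡y : ∀ {x y} → x + y ≡ 0# → x ≡ y
  x+y≡0⇒x≡y {x} {y} eq = trans (sym (x+y+y≡x x y)) (trans (cong (_+ y) eq) (+-identityˡ y))

  x≡y⇒x+y≡0 : ∀ {x y} → x ≡ y → x + y ≡ 0#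
  x≡y⇒x+y≡0 {x} refl = x+x≡0 x

  [x+y]²≡x²+y² : ∀ x y → (x + y) * (x + y) ≡ x * x + y * y
  [x+y]²≡x²+y² = solve 2 (λ x y → (x :+ y) :* (x :+ y) := x :* x :+ y :* y) refl

  x²≡y²⇒x≡y : ∀ {x y} → x * x ≡ y * y → x ≡ y
  x²≡y²⇒x≡y {x} {y} eq = x+y≡0⇒x≡y (x*x≡0⇒x≡0 (trans ([x+y]²≡x²+y² x y) (x≡y⇒x+y≡0 eq)))

  x^2^[1+i] : ∀ x i → x ^ (2 ℕ.^ suc i) ≡ x ^ (2 ℕ.^ i) * x ^ (2 ℕ.^ i)
  x^2^[1+i] x i = trans (cong (x ^_) (cong (2 ℕ.^ i ℕ.+_) (ℕP.+-identityʳ (2 ℕ.^ i)))) (^-+ x (2 ℕ.^ i) (2 ℕ.^ i))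

  frobenius : ∀ i x y → (x + y) ^ (2 ℕ.^ i) ≡ x ^ (2 ℕ.^ i) + y ^ (2 ℕ.^ i)
  frobenius zero x y = trans (*-identityʳ _) (sym (cong₂ _+_ (*-identityʳ x) (*-identityʳ y)))
  frobenius (suc i) x y = begin
    (x + y) ^ (2 ℕ.^ suc i)                          ≡⟨ x^2^[1+i] (x + y) i ⟩
    (x + y) ^ (2 ℕ.^ i) * (x + y) ^ (2 ℕ.^ i)        ≡⟨ cong (λ z → z * z) (frobenius i x y) ⟩
    (x ^ (2 ℕ.^ i) + y ^ (2 ℕ.^ i)) * (x ^ (2 ℕ.^ i) + y ^ (2 ℕ.^ i)) ≡⟨ [x+y]²≡x²+y² _ _ ⟩
    x ^ (2 ℕ.^ i) * x ^ (2 ℕ.^ i) + y ^ (2 ℕ.^ i) * y ^ (2 ℕ.^ i) ≡⟨ sym (cong₂ _+_ (x^2^[1+i] x i) (x^2^[1+i] y i)) ⟩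
    x ^ (2 ℕ.^ suc i) + y ^ (2 ℕ.^ suc i)            ∎
    where open ≡-Reasoning

  trAux-+ : ∀ i x y → trAux i (x + y) ≡ trAux i x + trAux i y
  trAux-+ zero x y = sym (+-identityˡ 0#)
  trAux-+ (suc i) x y = trans (cong₂ _+_ (trAux-+ i x y) (frobenius i x y)) (middle-swap _ _ _ _)
    where
    middle-swap : ∀ a b c d → (a + b) + (c + d) ≡ (a + c) + (b + d)
    middle-swap = solve 4 (λ a b c d → (a :+ b) :+ (c :+ d) := (a :+ c) :+ (b :+ d)) refl

  Tr-+ : ∀ x y → Tr (x + y) ≡ Tr x + Tr y
  Tr-+ = trAux-+ m

  trAux-square : ∀ i x → trAux i (x * x) + x ≡ trAux i x + x ^ (2 ℕ.^ i)
  trAux-square zero x = trans (+-identityˡ x) (sym (trans (+-identityˡ _) (*-identityʳ x)))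
  trAux-square (suc i) x = begin
    (trAux i (x * x) + (x * x) ^ (2 ℕ.^ i)) + x ≡⟨ swap (trAux i (x * x)) _ x ⟩
    (trAux i (x * x) + x) + (x * x) ^ (2 ℕ.^ i) ≡⟨ cong₂ _+_ (trAux-square i x) (^-distrib-* x x (2 ℕ.^ i)) ⟩
    (trAux i x + x ^ (2 ℕ.^ i)) + x ^ (2 ℕ.^ i) * x ^ (2 ℕ.^ i) ≡⟨ cong (_+_ (trAux i x + x ^ (2 ℕ.^ i))) (sym (x^2^[1+i] x i)) ⟩
    (trAux i x + x ^ (2 ℕ.^ i)) + x ^ (2 ℕ.^ suc i) ∎
    where
    open ≡-Reasoning
    swap : ∀ a b c → (a + b) + c ≡ (a + c) + b
    swap = solve 3 (λ a b c → (a :+ b) :+ c := (a :+ c) :+ b) refl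

  Tr-x² : ∀ x → Tr (x * x) ≡ Tr x
  Tr-x² x = begin
    Tr (x * x)             ≡⟨ sym (x+y+y≡x (Tr (x * x)) x) ⟩
    Tr (x * x) + x + x     ≡⟨ cong (_+ x) (trAux-square m x) ⟩
    Tr x + x ^ q + x       ≡⟨ cong (λ z → Tr x + z + x) (x^q≡x x) ⟩
    Tr x + x + x           ≡⟨ x+y+y≡x (Tr x) x ⟩
    Tr x                   ∎
    where open ≡-Reasoning

  trAux-² : ∀ i x → trAux i x * trAux i x ≡ trAux i (x * x)
  trAux-² zero x = zeroˡ 0#
  trAux-² (suc i) x = trans ([x+y]²≡x²+y² _ _) (cong₂ _+_ (trAux-² i x) (sym (^-distrib-* x x (2 ℕ.^ i))))

  Tr∈𝔽₂ : ∀ x → Tr x ≡ 0# ⊎ Tr x ≡ 1#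
  Tr∈𝔽₂ x with Tr x ≟ 0#
  ... | yes Tr≡0 = inj₁ Tr≡0
  ... | no Tr≢0 = inj₂ (*-cancelˡ Tr≢0 (trans (trans (trAux-² m x) (Tr-x² x)) (sym (*-identityʳ (Tr x)))))

  Tr≢0⇒Tr≡1 : ∀ {x} → Tr x ≢ 0# → Tr x ≡ 1#
  Tr≢0⇒Tr≡1 {x} Tr≢0 with Tr∈𝔽₂ x
  ... | inj₁ Tr≡0 = ⊥-elim (Tr≢0 Tr≡0)
  ... | inj₂ Tr≡1 = Tr≡1

  -- Polynomial functions of bounded degree, given by their Horner decomposition f x = a + x g x.
  data Degree≤ : ℕ → (Carrier → Carrier) → Set where
    const : ∀ {f} a → (∀ x → f x ≡ a) → Degree≤ 0 f
    horner : ∀ {n f} a g → Degree≤ n g → (∀ x → f x ≡ a + x * g x) → Degree≤ (suc n) f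

  data Monic : ℕ → (Carrier → Carrier) → Set where
    one : ∀ {f} → (∀ x → f x ≡ 1#) → Monic 0 f
    horner : ∀ {n f} a g → Monic n g → (∀ x → f x ≡ a + x * g x) → Monic (suc n) f

  Degree≤-suc : ∀ {n f} → Degree≤ n f → Degree≤ (suc n) f
  Degree≤-suc (const a f≡a) = horner a (λ _ → 0#) (const 0# (λ _ → refl))
    (λ x → trans (f≡a x) (sym (trans (cong (_+_ a) (zeroʳ x)) (+-identityʳ a))))
  Degree≤-suc (horner a g g≤n f≡) = horner a g (Degree≤-suc g≤n) f≡

  Degree≤-mono : ∀ {n k f} → n ℕ.≤ k → Degree≤ n f → Degree≤ k f
  Degree≤-mono {k = zero} ℕ.z≤n f≤n = f≤n
  Degree≤-mono {k = suc k} n≤1+k f≤n with ℕP.m≤n⇒m<n∨m≡n n≤1+k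
  ... | inj₁ (ℕ.s≤s n≤k) = Degree≤-suc (Degree≤-mono n≤k f≤n)
  ... | inj₂ refl = f≤n

  +-distrib-horner : ∀ a b x u v → (a + x * u) + (b + x * v) ≡ (a + b) + x * (u + v)
  +-distrib-horner = solve 5 (λ a b x u v → (a :+ x :* u) :+ (b :+ x :* v) := (a :+ b) :+ x :* (u :+ v)) refl

  Degree≤-+ : ∀ {n f g} → Degree≤ n f → Degree≤ n g → Degree≤ n (λ x → f x + g x)
  Degree≤-+ (const a f≡a) (const b g≡b) = const (a + b) (λ x → cong₂ _+_ (f≡a x) (g≡b x))
  Degree≤-+ (horner a f′ f′≤n f≡) (horner b g′ g′≤n g≡) = horner (a + b) (λ x → f′ x + g′ x) (Degree≤-+ f′≤n g′≤n)
    (λ x → trans (cong₂ _+_ (f≡ x) (g≡ x)) (+-distrib-horner a b x (f′ x) (g′ x)))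

  Monic⇒Degree≤ : ∀ {n f} → Monic n f → Degree≤ n f
  Monic⇒Degree≤ (one f≡1) = const 1# f≡1
  Monic⇒Degree≤ (horner a g g-monic f≡) = horner a g (Monic⇒Degree≤ g-monic) f≡

  Monic-+ : ∀ {n k f g} → Monic n f → Degree≤ k g → k ℕ.< n → Monic n (λ x → f x + g x)
  Monic-+ (horner a f′ f′-monic f≡) (const b g≡b) _ = horner (a + b) f′ f′-monic
    (λ x → trans (cong₂ _+_ (f≡ x) (g≡b x)) (swap a b (x * f′ x)))
    where
    swap : ∀ a b c → (a + c) + b ≡ (a + b) + c
    swap = solve 3 (λ a b c → (a :+ c) :+ b := (a :+ b) :+ c) refl
  Monic-+ (horner a f′ f′-monic f≡) (horner b g′ g′≤k g≡) (ℕ.s≤s k<n) = horner (a + b) (λ x → f′ x + g′ x)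
    (Monic-+ f′-monic g′≤k k<n) (λ x → trans (cong₂ _+_ (f≡ x) (g≡ x)) (+-distrib-horner a b x (f′ x) (g′ x)))

  Monic-cong : ∀ {n f g} → (∀ x → f x ≡ g x) → Monic n f → Monic n g
  Monic-cong f≗g (one f≡1) = one (λ x → trans (sym (f≗g x)) (f≡1 x))
  Monic-cong f≗g (horner a h h-monic f≡) = horner a h h-monic (λ x → trans (sym (f≗g x)) (f≡ x))

  ^-Monic : ∀ n → Monic n (_^ n)
  ^-Monic zero = one (λ _ → refl)
  ^-Monic (suc n) = horner 0# (_^ n) (^-Monic n) (λ x → sym (+-identityˡ _))

  Monic-factor : ∀ {n f} → Monic (suc n) f → ∀ r →
    ∃[ g ] Monic n g × (∀ x → f x ≡ f r + (x + r) * g x)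
  Monic-factor {f = f} (horner a f′ (one f′≡1) f≡) r = (λ _ → 1#) , one (λ _ → refl) , λ x → begin
    f x                             ≡⟨ f≡ x ⟩
    a + x * f′ x                    ≡⟨ cong (λ z → a + x * z) (f′≡1 x) ⟩
    a + x * 1#                      ≡⟨ linear a x r ⟩
    (a + r * 1#) + (x + r) * 1#     ≡⟨ cong (λ z → (a + r * z) + (x + r) * 1#) (sym (f′≡1 r)) ⟩
    (a + r * f′ r) + (x + r) * 1#   ≡⟨ cong (λ z → z + (x + r) * 1#) (sym (f≡ r)) ⟩
    f r + (x + r) * 1#              ∎
    where
    open ≡-Reasoning
    linear : ∀ a x r → a + x * 1# ≡ (a + r * 1#) + (x + r) * 1#
    linear = solve 3 (λ a x r → a :+ x :* con true := (a :+ r :* con true) :+ (x :+ r) :* con true) refl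
  Monic-factor {f = f} (horner a f′ f′-monic@(horner _ _ _ _) f≡) r with Monic-factor f′-monic r
  ... | g′ , g′-monic , f′≡ = (λ x → f′ r + x * g′ x) , horner (f′ r) g′ g′-monic (λ _ → refl) , λ x → begin
    f x                                             ≡⟨ f≡ x ⟩
    a + x * f′ x                                    ≡⟨ cong (λ z → a + x * z) (f′≡ x) ⟩
    a + x * (f′ r + (x + r) * g′ x)                 ≡⟨ shift a x r (f′ r) (g′ x) ⟩
    (a + r * f′ r) + (x + r) * (f′ r + x * g′ x)    ≡⟨ cong (λ z → z + (x + r) * (f′ r + x * g′ x)) (sym (f≡ r)) ⟩
    f r + (x + r) * (f′ r + x * g′ x)               ∎
    where
    open ≡-Reasoning
    shift : ∀ a x r u v → a + x * (u + (x + r) * v) ≡ (a + r * u) + (x + r) * (u + x * v)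
    shift = solve 5 (λ a x r u v → a :+ x :* (u :+ (x :+ r) :* v) := (a :+ r :* u) :+ (x :+ r) :* (u :+ x :* v)) refl

  Monic-roots : ∀ {n f} → Monic n f → (rs : List Carrier) → Unique rs → All (λ r → f r ≡ 0#) rs → length rs ℕ.≤ n
  Monic-roots _ [] _ _ = ℕ.z≤n
  Monic-roots (one f≡1) (r ∷ _) _ (fr≡0 ∷ _) = ⊥-elim (1≢0 (trans (sym (f≡1 r)) fr≡0))
  Monic-roots {suc n} {f} f-monic@(horner _ _ _ _) (r ∷ rs) (r∉rs ∷ rs-unique) (fr≡0 ∷ rs-roots)
    with Monic-factor f-monic r
  ... | g , g-monic , f≡ = ℕ.s≤s (Monic-roots g-monic rs rs-unique (zipWith root-of-g (r∉rs , rs-roots)))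
    where
    root-of-g : ∀ {s} → r ≢ s × f s ≡ 0# → g s ≡ 0#
    root-of-g {s} (r≢s , fs≡0) = x*y≡0⇒y≡0 (r≢s ∘ sym ∘ x+y≡0⇒x≡y)
      (trans (sym (trans (f≡ s) (trans (cong (_+ (s + r) * g s) fr≡0) (+-identityˡ _)))) fs≡0)

  trAux-degree< : ∀ i → ∃[ d ] d ℕ.< 2 ℕ.^ i × Degree≤ d (trAux i)
  trAux-degree< zero = 0 , ℕ.s≤s ℕ.z≤n , const 0# (λ _ → refl)
  trAux-degree< (suc i) with trAux-degree< i
  ... | d , d<2^i , trAux≤d = 2 ℕ.^ i , ℕP.^-monoʳ-< 2 (ℕP.n<1+n 1) (ℕP.n<1+n i) ,
    Degree≤-+ (Degree≤-mono (ℕP.<⇒≤ d<2^i) trAux≤d) (Monic⇒Degree≤ (^-Monic (2 ℕ.^ i)))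

  trAux-Monic : ∀ i → Monic (2 ℕ.^ i) (trAux (suc i))
  trAux-Monic i with trAux-degree< i
  ... | d , d<2^i , trAux≤d = Monic-cong (λ x → +-comm _ _) (Monic-+ (^-Monic (2 ℕ.^ i)) trAux≤d d<2^i)

  -- Tr is a monic polynomial of degree 2^(m-1) < q, so it cannot vanish on all of 𝔽_q.
  ¬∀Tr≡0 : ¬ (∀ x → Tr x ≡ 0#)
  ¬∀Tr≡0 Tr≡0 = ℕP.<⇒≱ 2^[m-1]<q (subst (ℕ._≤ 2 ℕ.^ ℕ.pred m) (length-tabulate elem)
    (Monic-roots Tr-monic (tabulate elem) (Unique.tabulate⁺ elem-injective) (All.tabulate⁺ (Tr≡0 ∘ elem))))
    where
    1+[m-1]≡m : suc (ℕ.pred m) ≡ m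
    1+[m-1]≡m = ℕP.suc-pred m ⦃ ℕ.≢-nonZero m≢0 ⦄
    Tr-monic : Monic (2 ℕ.^ ℕ.pred m) Tr
    Tr-monic = subst (λ k → Monic (2 ℕ.^ ℕ.pred m) (trAux k)) 1+[m-1]≡m (trAux-Monic (ℕ.pred m))
    2^[m-1]<q : 2 ℕ.^ ℕ.pred m ℕ.< q
    2^[m-1]<q = ℕP.^-monoʳ-< 2 (ℕP.n<1+n 1) (subst (ℕ.pred m ℕ.<_) 1+[m-1]≡m (ℕP.n<1+n (ℕ.pred m)))
    elem-injective : ∀ {i j} → elem i ≡ elem j → i ≡ j
    elem-injective {i} {j} eq = trans (sym (index-elem i)) (trans (cong index eq) (index-elem j))

  ∃Tr≡1 : ∃[ δ ] Tr δ ≡ 1#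
  ∃Tr≡1 with any? (λ i → ¬? (Tr (elem i) ≟ 0#))
  ... | yes (i , Tr≢0) = elem i , Tr≢0⇒Tr≡1 Tr≢0
  ... | no ∄ = ⊥-elim (¬∀Tr≡0 (λ x → subst (λ y → Tr y ≡ 0#) (elem-index x)
                       (decidable-stable (Tr (elem (index x)) ≟ 0#) (λ Tr≢0 → ∄ (index x , Tr≢0)))))

  χ-Tr≡0 : ∀ {x} → Tr x ≡ 0# → χ x ≡ + 1
  χ-Tr≡0 {x} Tr≡0 with Tr x ≟ 0#
  ... | yes _ = refl
  ... | no Tr≢0 = ⊥-elim (Tr≢0 Tr≡0)

  χ-Tr≢0 : ∀ {x} → Tr x ≢ 0# → χ x ≡ -ℤ + 1
  χ-Tr≢0 {x} Tr≢0 with Tr x ≟ 0#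
  ... | yes Tr≡0 = ⊥-elim (Tr≢0 Tr≡0)
  ... | no _ = refl

  χ-Tr≡1 : ∀ {x} → Tr x ≡ 1# → χ x ≡ -ℤ + 1
  χ-Tr≡1 Tr≡1 = χ-Tr≢0 (λ Tr≡0 → 0≢1 (trans (sym Tr≡0) Tr≡1))

  χ-+ : ∀ x y → χ (x + y) ≡ χ x *ℤ χ y
  χ-+ x y with Tr∈𝔽₂ x | Tr∈𝔽₂ y
  ... | inj₁ p | inj₁ q = trans (χ-Tr≡0 (trans (trans (Tr-+ x y) (cong₂ _+_ p q)) (+-identityˡ 0#)))
    (sym (cong₂ _*ℤ_ (χ-Tr≡0 p) (χ-Tr≡0 q)))
  ... | inj₁ p | inj₂ q = trans (χ-Tr≡1 (trans (trans (Tr-+ x y) (cong₂ _+_ p q)) (+-identityˡ 1#)))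
    (sym (cong₂ _*ℤ_ (χ-Tr≡0 p) (χ-Tr≡1 q)))
  ... | inj₂ p | inj₁ q = trans (χ-Tr≡1 (trans (trans (Tr-+ x y) (cong₂ _+_ p q)) (+-identityʳ 1#)))
    (sym (cong₂ _*ℤ_ (χ-Tr≡1 p) (χ-Tr≡0 q)))
  ... | inj₂ p | inj₂ q = trans (χ-Tr≡0 (trans (trans (Tr-+ x y) (cong₂ _+_ p q)) 1+1≡0))
    (sym (cong₂ _*ℤ_ (χ-Tr≡1 p) (χ-Tr≡1 q)))

  χ-x² : ∀ x → χ (x * x) ≡ χ x
  χ-x² x with Tr∈𝔽₂ x
  ... | inj₁ p = trans (χ-Tr≡0 (trans (Tr-x² x) p)) (sym (χ-Tr≡0 p))
  ... | inj₂ p = trans (χ-Tr≡1 (trans (Tr-x² x) p)) (sym (χ-Tr≡1 p))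

  Tr[x²+x]≡0 : ∀ x → Tr (x * x + x) ≡ 0#
  Tr[x²+x]≡0 x = trans (Tr-+ (x * x) x) (trans (cong (_+ Tr x) (Tr-x² x)) (x+x≡0 (Tr x)))

  Σχ≡0 : Σ χ ≡ + 0
  Σχ≡0 = s≡-s⇒s≡0 (Σ χ) (begin
    Σ χ                          ≡⟨ sym (Σ-reindex (+-↔ δ) χ) ⟩
    Σ (λ x → χ (x + δ))          ≡⟨ Σ-cong (λ x → trans (χ-+ x δ) (cong (χ x *ℤ_) (χ-Tr≡1 Trδ≡1))) ⟩
    Σ (λ x → χ x *ℤ -ℤ + 1)      ≡⟨ Σ-cong (λ x → ℤP.*-comm (χ x) (-ℤ + 1)) ⟩
    Σ (λ x → -ℤ + 1 *ℤ χ x)      ≡⟨ Σ-scale (-ℤ + 1) χ ⟩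
    -ℤ + 1 *ℤ Σ χ                ≡⟨ ℤP.-1*i≡-i (Σ χ) ⟩
    -ℤ Σ χ                       ∎)
    where
    open ≡-Reasoning
    δ = proj₁ ∃Tr≡1
    Trδ≡1 = proj₂ ∃Tr≡1
    s≡-s⇒s≡0 : ∀ s → s ≡ -ℤ s → s ≡ + 0
    s≡-s⇒s≡0 (+ zero) _ = refl
    s≡-s⇒s≡0 (+ suc n) ()
    s≡-s⇒s≡0 ℤ.-[1+ n ] ()

  N : Carrier → ℤ
  N b = Σ (λ t → 𝟙 ((t * t + t) ≟ b))

  N≡0 : ∀ {b} → (∀ t → t * t + t ≢ b) → N b ≡ + 0
  N≡0 {b} no-root = trans (Σ-cong (λ t → 𝟙-no ((t * t + t) ≟ b) (no-root t))) (sum-replicate-zero q)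

  x≢x+1 : ∀ x → x ≢ x + 1#
  x≢x+1 x x≡x+1 = 1≢0 (trans (sym (x+y+y≡x 1# x)) (trans (cong (_+ x) (+-comm 1# x)) (x≡y⇒x+y≡0 (sym x≡x+1))))

  N≡2 : ∀ {b t₀} → t₀ * t₀ + t₀ ≡ b → N b ≡ + 2
  N≡2 {b} {t₀} t₀-root = begin
    N b                                           ≡⟨ Σ-cong (λ t → 𝟙-⊎ ((t * t + t) ≟ b) (t ≟ t₀) (t ≟ (t₀ + 1#))
                                                       (only-roots t) (roots t) (λ (p , q) → x≢x+1 t₀ (trans (sym p) q))) ⟩
    Σ (λ t → 𝟙 (t ≟ t₀) +ℤ 𝟙 (t ≟ (t₀ + 1#)))     ≡⟨ Σ-+ (λ t → 𝟙 (t ≟ t₀)) (λ t → 𝟙 (t ≟ (t₀ + 1#))) ⟩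
    Σ (λ t → 𝟙 (t ≟ t₀)) +ℤ Σ (λ t → 𝟙 (t ≟ (t₀ + 1#))) ≡⟨ cong₂ _+ℤ_ (Σ-δ t₀) (Σ-δ (t₀ + 1#)) ⟩
    + 2                                           ∎
    where
    open ≡-Reasoning
    factor : ∀ t t₀ → (t * t + t) + (t₀ * t₀ + t₀) ≡ (t + t₀) * (t + t₀ + 1#)
    factor = solve 2 (λ t t₀ → (t :* t :+ t) :+ (t₀ :* t₀ :+ t₀) := (t :+ t₀) :* (t :+ t₀ :+ con true)) refl
    shift : ∀ t₀ → (t₀ + 1#) * (t₀ + 1#) + (t₀ + 1#) ≡ t₀ * t₀ + t₀
    shift = solve 1 (λ t₀ → (t₀ :+ con true) :* (t₀ :+ con true) :+ (t₀ :+ con true) := t₀ :* t₀ :+ t₀) refl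
    only-roots : ∀ t → t * t + t ≡ b → t ≡ t₀ ⊎ t ≡ t₀ + 1#
    only-roots t t-root with (t + t₀) ≟ 0#
    ... | yes t+t₀≡0 = inj₁ (x+y≡0⇒x≡y t+t₀≡0)
    ... | no t+t₀≢0 = inj₂ (x+y≡0⇒x≡y (trans (sym (+-assoc t t₀ 1#))
      (x*y≡0⇒y≡0 t+t₀≢0 (trans (sym (factor t t₀)) (x≡y⇒x+y≡0 (trans t-root (sym t₀-root)))))))
    roots : ∀ t → t ≡ t₀ ⊎ t ≡ t₀ + 1# → t * t + t ≡ b
    roots t (inj₁ refl) = t₀-root
    roots t (inj₂ refl) = trans (shift t₀) t₀-root

  N-deficit : ∀ b → ∃[ d ] + d ≡ (+ 1 +ℤ χ b) - N b
  N-deficit b = by-trace (Tr b ≟ 0#)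
    where
    by-trace : Dec (Tr b ≡ 0#) → ∃[ d ] + d ≡ (+ 1 +ℤ χ b) - N b
    by-trace (no Tr≢0) = 0 , sym (cong₂ (λ u v → (+ 1 +ℤ u) - v) (χ-Tr≢0 Tr≢0)
      (N≡0 (λ t t-root → Tr≢0 (trans (cong Tr (sym t-root)) (Tr[x²+x]≡0 t)))))
    by-trace (yes Tr≡0) with any? (λ i → (elem i * elem i + elem i) ≟ b)
    ... | yes (i , root) = 0 , sym (cong₂ (λ u v → (+ 1 +ℤ u) - v) (χ-Tr≡0 Tr≡0) (N≡2 root))
    ... | no ∄root = 2 , sym (cong₂ (λ u v → (+ 1 +ℤ u) - v) (χ-Tr≡0 Tr≡0)
      (N≡0 (λ t t-root → ∄root (index t , subst (λ s → s * s + s ≡ b) (sym (elem-index t)) t-root))))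

  ΣN≡q : Σ N ≡ + q
  ΣN≡q = begin
    Σ N                                         ≡⟨ ∑-comm (λ i j → 𝟙 ((elem j * elem j + elem j) ≟ elem i)) ⟩
    Σ (λ t → Σ (λ b → 𝟙 ((t * t + t) ≟ b)))     ≡⟨ Σ-cong (λ t → Σ-δ′ (t * t + t)) ⟩
    Σ (λ _ → + 1)                               ≡⟨ Σ-ones ⟩
    + q                                         ∎
    where open ≡-Reasoning

  -- N b ≤ 1 + χ b for every b, and both sides sum to q over b.
  N≡1+χ : ∀ b → N b ≡ + 1 +ℤ χ b
  N≡1+χ b = sym (ℤP.i-j≡0⇒i≡j _ _ (begin
    (+ 1 +ℤ χ b) - N b   ≡⟨ sym (proj₂ (N-deficit b)) ⟩
    + deficit b          ≡⟨ cong +_ (subst (λ y → deficit y ≡ 0) (elem-index b) (sumℕ≡0⇒≡0 (deficit ∘ elem) Σdeficit≡0 (index b))) ⟩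
    + 0                  ∎))
    where
    open ≡-Reasoning
    deficit : Carrier → ℕ
    deficit = proj₁ ∘ N-deficit
    Σdeficit≡0 : sumℕ (deficit ∘ elem) ≡ 0
    Σdeficit≡0 = ℤP.+-injective (begin
      + sumℕ (deficit ∘ elem)                 ≡⟨ sym (sum-+≡+sumℕ (deficit ∘ elem)) ⟩
      Σ (λ y → + deficit y)                    ≡⟨ Σ-cong (proj₂ ∘ N-deficit) ⟩
      Σ (λ y → (+ 1 +ℤ χ y) +ℤ -ℤ N y)         ≡⟨ Σ-+ (λ y → + 1 +ℤ χ y) (λ y → -ℤ N y) ⟩
      Σ (λ y → + 1 +ℤ χ y) +ℤ Σ (λ y → -ℤ N y) ≡⟨ cong₂ _+ℤ_ (Σ-+ (λ _ → + 1) χ) (Σ-neg N) ⟩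
      (Σ (λ _ → + 1) +ℤ Σ χ) - Σ N             ≡⟨ cong₂ (λ u v → (u +ℤ v) - Σ N) Σ-ones Σχ≡0 ⟩
      (+ q +ℤ + 0) - Σ N                       ≡⟨ cong₂ _-_ (ℤP.+-identityʳ (+ q)) ΣN≡q ⟩
      + q - + q                                ≡⟨ ℤP.+-inverseʳ (+ q) ⟩
      + 0                                      ∎)

  -- Identities involving x⁻¹ are proved by the solver as polynomial identities in x and x⁻¹
  -- that hold up to a multiple of 1 + x x⁻¹.
  p+[1+x*x⁻¹]*r≡p : ∀ {x} → x ≢ 0# → ∀ p r → p + (1# + x * x ⁻¹) * r ≡ p
  p+[1+x*x⁻¹]*r≡p {x} x≢0 p r = begin
    p + (1# + x * x ⁻¹) * r    ≡⟨ cong (λ y → p + (1# + y) * r) (inverseʳ x x≢0) ⟩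
    p + (1# + 1#) * r          ≡⟨ cong (λ y → p + y * r) 1+1≡0 ⟩
    p + 0# * r                 ≡⟨ cong (_+_ p) (zeroˡ r) ⟩
    p + 0#                     ≡⟨ +-identityʳ p ⟩
    p                          ∎
    where open ≡-Reasoning

  kTerm-0 : ∀ a → kTerm a 0# ≡ + 0
  kTerm-0 a with 0# ≟ 0#
  ... | yes _ = refl
  ... | no 0≢0 = ⊥-elim (0≢0 refl)

  kTerm-≢0 : ∀ a {x} → x ≢ 0# → kTerm a x ≡ χ (x + a * x ⁻¹)
  kTerm-≢0 a {x} x≢0 with x ≟ 0#
  ... | yes x≡0 = ⊥-elim (x≢0 x≡0)
  ... | no _ = refl

  K≡Σ : ∀ a → K a ≡ Σ (kTerm a)
  K≡Σ a = foldr-allFin≡sum q (kTerm a ∘ elem)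

-- The curve Y² + XY + c²Y = X³

module Curve {m : ℕ} (F : FiniteField2^ m) (c : FiniteField2^.Carrier F)
             (c≢0 : c ≢ FiniteField2^.0# F) (c≢1 : c ≢ FiniteField2^.1# F) where
  open Field F

  v : Carrier
  v = c * c

  a : Carrier
  a = c ^ 4 + c ^ 3

  v≢0 : v ≢ 0#
  v≢0 = x*y≢0 c≢0 c≢0

  OnCurve : Carrier → Carrier → Set
  OnCurve X Y = Y * Y + X * Y + v * Y ≡ X * X * X

  onCurve? : ∀ X Y → Dec (OnCurve X Y)
  onCurve? X Y = (Y * Y + X * Y + v * Y) ≟ (X * X * X)

  fibre : Carrier → ℤ
  fibre X = Σ (λ Y → 𝟙 (onCurve? X Y))

  fibre-v : fibre v ≡ + 1
  fibre-v = trans (Σ-cong (λ Y → 𝟙-cong (x²≡y²⇒x≡y ∘ on-v⇒ Y) (on-v⇐ Y) (onCurve? v Y) (Y ≟ (c * c * c))))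
                  (Σ-δ (c * c * c))
    where
    on-v : ∀ Y c → Y * Y + (c * c) * Y + (c * c) * Y ≡ Y * Y
    on-v = solve 2 (λ Y c → Y :* Y :+ (c :* c) :* Y :+ (c :* c) :* Y := Y :* Y) refl
    c⁶ : ∀ c → (c * c) * (c * c) * (c * c) ≡ (c * c * c) * (c * c * c)
    c⁶ = solve 1 (λ c → (c :* c) :* (c :* c) :* (c :* c) := (c :* c :* c) :* (c :* c :* c)) refl
    on-v⇒ : ∀ Y → OnCurve v Y → Y * Y ≡ (c * c * c) * (c * c * c)
    on-v⇒ Y on = trans (sym (on-v Y c)) (trans on (c⁶ c))
    on-v⇐ : ∀ Y → Y ≡ c * c * c → OnCurve v Y
    on-v⇐ Y refl = trans (on-v Y c) (sym (c⁶ c))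

  b : Carrier → Carrier
  b X = X * X * X * ((X + v) * (X + v)) ⁻¹

  -- Substituting Y = (X + v) t turns the curve equation into t² + t = b X.
  fibre≢v : ∀ {X} → X ≢ v → fibre X ≡ + 1 +ℤ χ (b X)
  fibre≢v {X} X≢v = begin
    fibre X                                 ≡⟨ sym (Σ-reindex (*-↔ D≢0) (λ Y → 𝟙 (onCurve? X Y))) ⟩
    Σ (λ t → 𝟙 (onCurve? X (D * t)))       ≡⟨ Σ-cong (λ t → 𝟙-cong (*≡⇒≡*⁻¹ D²≢0 ∘ trans (sym (substitute X v t)))
                                                                 (trans (substitute X v t) ∘ ≡*⁻¹⇒*≡ D²≢0)
                                                                 (onCurve? X (D * t)) ((t * t + t) ≟ b X)) ⟩
    N (b X)                                 ≡⟨ N≡1+χ (b X) ⟩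
    + 1 +ℤ χ (b X)                          ∎
    where
    open ≡-Reasoning
    D = X + v
    D≢0 : D ≢ 0#
    D≢0 = X≢v ∘ x+y≡0⇒x≡y
    D²≢0 : D * D ≢ 0#
    D²≢0 = x*y≢0 D≢0 D≢0
    substitute : ∀ X v t → (X + v) * t * ((X + v) * t) + X * ((X + v) * t) + v * ((X + v) * t) ≡ ((X + v) * (X + v)) * (t * t + t)
    substitute = solve 3 (λ X v t → (X :+ v) :* t :* ((X :+ v) :* t) :+ X :* ((X :+ v) :* t) :+ v :* ((X :+ v) :* t)
                                  := ((X :+ v) :* (X :+ v)) :* (t :* t :+ t)) refl

  b-shift : ∀ {x} → x ≢ 0# → let z = c * c * c * x ⁻¹ in b (x + v) ≡ (x + a * x ⁻¹) + c * c + (z * z + z)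
  b-shift {x} x≢0 = begin
    (x + v) * (x + v) * (x + v) * ((x + v + v) * (x + v + v)) ⁻¹ ≡⟨ cong (λ y → (x + v) * (x + v) * (x + v) * (y * y) ⁻¹) (x+y+y≡x x v) ⟩
    (x + v) * (x + v) * (x + v) * (x * x) ⁻¹                     ≡⟨ cong ((x + v) * (x + v) * (x + v) *_) (⁻¹-* x≢0 x≢0) ⟩
    (x + v) * (x + v) * (x + v) * (i * i)                         ≡⟨ expand x i c ⟩
    ((x + a * i) + c * c + (z * z + z)) + (1# + x * i) * ((x + c * c) * (x * i + 1#) + c * c * c * c * i)
                                                                  ≡⟨ p+[1+x*x⁻¹]*r≡p x≢0 _ _ ⟩
    (x + a * i) + c * c + (z * z + z)                             ∎
    where
    open ≡-Reasoning
    i = x ⁻¹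
    z = c * c * c * i
    expand : ∀ x i c → (x + c * c) * (x + c * c) * (x + c * c) * (i * i) ≡
      ((x + (c * (c * (c * (c * 1#))) + c * (c * (c * 1#))) * i) + c * c + (c * c * c * i * (c * c * c * i) + c * c * c * i))
        + (1# + x * i) * ((x + c * c) * (x * i + 1#) + c * c * c * c * i)
    expand = solve 3 (λ x i c → (x :+ c :* c) :* (x :+ c :* c) :* (x :+ c :* c) :* (i :* i) :=
      ((x :+ (c :* (c :* (c :* (c :* con true))) :+ c :* (c :* (c :* con true))) :* i) :+ c :* c
        :+ (c :* c :* c :* i :* (c :* c :* c :* i) :+ c :* c :* c :* i))
        :+ (con true :+ x :* i) :* ((x :+ c :* c) :* (x :* i :+ con true) :+ c :* c :* c :* c :* i)) refl

  fibre-shift : ∀ x → fibre (x + v) ≡ + 1 +ℤ χ c *ℤ kTerm a x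
  fibre-shift x = by-cases (x ≟ 0#)
    where
    open ≡-Reasoning
    by-cases : Dec (x ≡ 0#) → fibre (x + v) ≡ + 1 +ℤ χ c *ℤ kTerm a x
    by-cases (yes refl) = begin
      fibre (0# + v)            ≡⟨ cong fibre (+-identityˡ v) ⟩
      fibre v                   ≡⟨ fibre-v ⟩
      + 1 +ℤ + 0                ≡⟨ cong (_+ℤ_ (+ 1)) (sym (trans (cong (χ c *ℤ_) (kTerm-0 a)) (ℤP.*-zeroʳ (χ c)))) ⟩
      + 1 +ℤ χ c *ℤ kTerm a 0#  ∎
    by-cases (no x≢0) = begin
      fibre (x + v)                                  ≡⟨ fibre≢v (x≢0 ∘ x+v≡v⇒x≡0) ⟩
      + 1 +ℤ χ (b (x + v))                           ≡⟨ cong (λ y → + 1 +ℤ χ y) (b-shift x≢0) ⟩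
      + 1 +ℤ χ ((x + a * i) + c * c + (z * z + z))   ≡⟨ cong (_+ℤ_ (+ 1)) χ-b ⟩
      + 1 +ℤ χ c *ℤ kTerm a x                        ∎
      where
      i = x ⁻¹
      z = c * c * c * i
      x+v≡v⇒x≡0 : x + v ≡ v → x ≡ 0#
      x+v≡v⇒x≡0 eq = trans (sym (x+y+y≡x x v)) (x≡y⇒x+y≡0 eq)
      χ-b : χ ((x + a * i) + c * c + (z * z + z)) ≡ χ c *ℤ kTerm a x
      χ-b = begin
        χ ((x + a * i) + c * c + (z * z + z))      ≡⟨ χ-+ _ _ ⟩
        χ ((x + a * i) + c * c) *ℤ χ (z * z + z)   ≡⟨ cong₂ _*ℤ_ (χ-+ _ _) (χ-Tr≡0 (Tr[x²+x]≡0 z)) ⟩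
        χ (x + a * i) *ℤ χ (c * c) *ℤ + 1          ≡⟨ ℤP.*-identityʳ _ ⟩
        χ (x + a * i) *ℤ χ (c * c)                 ≡⟨ cong (χ (x + a * i) *ℤ_) (χ-x² c) ⟩
        χ (x + a * i) *ℤ χ c                       ≡⟨ ℤP.*-comm _ (χ c) ⟩
        χ c *ℤ χ (x + a * i)                       ≡⟨ cong (χ c *ℤ_) (sym (kTerm-≢0 a x≢0)) ⟩
        χ c *ℤ kTerm a x                           ∎

  Σfibre : Σ fibre ≡ + q +ℤ χ c *ℤ K a
  Σfibre = begin
    Σ fibre                                              ≡⟨ sym (Σ-reindex (+-↔ v) fibre) ⟩
    Σ (λ x → fibre (x + v))                              ≡⟨ Σ-cong fibre-shift ⟩
    Σ (λ x → + 1 +ℤ χ c *ℤ kTerm a x)                    ≡⟨ Σ-+ (λ _ → + 1) (λ x → χ c *ℤ kTerm a x) ⟩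
    Σ (λ _ → + 1) +ℤ Σ (λ x → χ c *ℤ kTerm a x)          ≡⟨ cong₂ _+ℤ_ Σ-ones (Σ-scale (χ c) (kTerm a)) ⟩
    + q +ℤ χ c *ℤ Σ (kTerm a)                            ≡⟨ cong (λ k → + q +ℤ χ c *ℤ k) (sym (K≡Σ a)) ⟩
    + q +ℤ χ c *ℤ K a                                    ∎
    where open ≡-Reasoning

  E′ : Carrier → Carrier → Carrier
  E′ X s = X * X + (s * s + s) * X + v * s

  OnCurve⇔E′≡0 : ∀ {X} s → X ≢ 0# → (OnCurve X (X * s) → E′ X s ≡ 0#) × (E′ X s ≡ 0# → OnCurve X (X * s))
  OnCurve⇔E′≡0 {X} s X≢0 =
    (λ on → x*y≡0⇒y≡0 X≢0 (trans (sym (factor X s v)) (x≡y⇒x+y≡0 on))) ,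
    (λ E′≡0 → x+y≡0⇒x≡y (trans (factor X s v) (trans (cong (X *_) E′≡0) (zeroʳ X))))
    where
    factor : ∀ X s v → (X * s) * (X * s) + X * (X * s) + v * (X * s) + X * X * X ≡ X * (X * X + (s * s + s) * X + v * s)
    factor = solve 3 (λ X s v → (X :* s) :* (X :* s) :+ X :* (X :* s) :+ v :* (X :* s) :+ X :* X :* X
                              := X :* (X :* X :+ (s :* s :+ s) :* X :+ v :* s)) refl

  OnChart : Carrier × Carrier → Set
  OnChart (X , s) = X ≢ 0# × E′ X s ≡ 0#

  onChart? : ∀ p → Dec (OnChart p)
  onChart? (X , s) = ¬? (X ≟ 0#) ×-dec (E′ X s ≟ 0#)

  -- The automorphism (X, Y) ↦ (c²Y/X², c⁴Y/X³) in the coordinates (X, s = Y/X).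
  τ : Carrier × Carrier → Carrier × Carrier
  τ (X , s) = (v * s * X ⁻¹ , v * X ⁻¹)

  OnChart⇒s≢0 : ∀ {X s} → OnChart (X , s) → s ≢ 0#
  OnChart⇒s≢0 {X} {s} (X≢0 , E′≡0) refl = X≢0 (x*x≡0⇒x≡0 (trans (sym (E′-s≡0 X v)) E′≡0))
    where
    E′-s≡0 : ∀ X v → X * X + (0# * 0# + 0#) * X + v * 0# ≡ X * X
    E′-s≡0 = solve 2 (λ X v → X :* X :+ (con false :* con false :+ con false) :* X :+ v :* con false := X :* X) refl

  E′-τ : ∀ {X} s → X ≢ 0# → let i = X ⁻¹ in E′ (v * s * i) (v * i) ≡ v * v * i * i * i * E′ X s
  E′-τ {X} s X≢0 = trans (expand v s (X ⁻¹) X) (p+[1+x*x⁻¹]*r≡p X≢0 _ _)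
    where
    expand : ∀ v s i X →
      (v * s * i) * (v * s * i) + ((v * i) * (v * i) + v * i) * (v * s * i) + v * (v * i)
        ≡ v * v * i * i * i * (X * X + (s * s + s) * X + v * s)
          + (1# + X * i) * (v * v * i * (1# + X * i) + v * v * s * s * i * i + v * v * s * i * i)
    expand = solve 4 (λ v s i X →
      (v :* s :* i) :* (v :* s :* i) :+ ((v :* i) :* (v :* i) :+ v :* i) :* (v :* s :* i) :+ v :* (v :* i)
        := v :* v :* i :* i :* i :* (X :* X :+ (s :* s :+ s) :* X :+ v :* s)
          :+ (con true :+ X :* i) :* (v :* v :* i :* (con true :+ X :* i) :+ v :* v :* s :* s :* i :* i :+ v :* v :* s :* i :* i)) refl

  τ-OnChart : ∀ {p} → OnChart p → OnChart (τ p)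
  τ-OnChart {X , s} A@(X≢0 , E′≡0) =
    x*y≢0 (x*y≢0 v≢0 (OnChart⇒s≢0 A)) (⁻¹≢0 X≢0) ,
    trans (E′-τ s X≢0) (trans (cong (v * v * X ⁻¹ * X ⁻¹ * X ⁻¹ *_) E′≡0) (zeroʳ _))

  τ² : ∀ {X s} → OnChart (X , s) → τ (τ (X , s)) ≡ (v * s ⁻¹ , X * s ⁻¹)
  τ² {X} {s} A@(X≢0 , _) = cong₂ _,_ X₂≡ s₂≡
    where
    open ≡-Reasoning
    s≢0 = OnChart⇒s≢0 A
    X₁⁻¹≡ : (v * s * X ⁻¹) ⁻¹ ≡ v ⁻¹ * s ⁻¹ * X
    X₁⁻¹≡ = sym (⁻¹-unique (begin
      v * s * X ⁻¹ * (v ⁻¹ * s ⁻¹ * X)            ≡⟨ regroup v s (X ⁻¹) (v ⁻¹) (s ⁻¹) X ⟩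
      1# * (v * v ⁻¹) * (s * s ⁻¹) * (X * X ⁻¹)   ≡⟨ cancel-all ⟩
      1#                                          ∎))
      where
      regroup : ∀ v s i v′ s′ X → v * s * i * (v′ * s′ * X) ≡ 1# * (v * v′) * (s * s′) * (X * i)
      regroup = solve 6 (λ v s i v′ s′ X → v :* s :* i :* (v′ :* s′ :* X) := con true :* (v :* v′) :* (s :* s′) :* (X :* i)) refl
      cancel-all = trans (y*[x*x⁻¹]≡y X≢0 _) (trans (y*[x*x⁻¹]≡y s≢0 _) (y*[x*x⁻¹]≡y v≢0 _))
    X₂≡ : v * (v * X ⁻¹) * (v * s * X ⁻¹) ⁻¹ ≡ v * s ⁻¹
    X₂≡ = begin
      v * (v * X ⁻¹) * (v * s * X ⁻¹) ⁻¹          ≡⟨ cong (v * (v * X ⁻¹) *_) X₁⁻¹≡ ⟩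
      v * (v * X ⁻¹) * (v ⁻¹ * s ⁻¹ * X)          ≡⟨ regroup v (X ⁻¹) (v ⁻¹) (s ⁻¹) X ⟩
      v * s ⁻¹ * (v * v ⁻¹) * (X * X ⁻¹)          ≡⟨ trans (y*[x*x⁻¹]≡y X≢0 _) (y*[x*x⁻¹]≡y v≢0 _) ⟩
      v * s ⁻¹                                    ∎
      where
      regroup : ∀ v i v′ s′ X → v * (v * i) * (v′ * s′ * X) ≡ v * s′ * (v * v′) * (X * i)
      regroup = solve 5 (λ v i v′ s′ X → v :* (v :* i) :* (v′ :* s′ :* X) := v :* s′ :* (v :* v′) :* (X :* i)) refl
    s₂≡ : v * (v * s * X ⁻¹) ⁻¹ ≡ X * s ⁻¹
    s₂≡ = begin
      v * (v * s * X ⁻¹) ⁻¹                       ≡⟨ cong (v *_) X₁⁻¹≡ ⟩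
      v * (v ⁻¹ * s ⁻¹ * X)                       ≡⟨ regroup v (v ⁻¹) (s ⁻¹) X ⟩
      X * s ⁻¹ * (v * v ⁻¹)                       ≡⟨ y*[x*x⁻¹]≡y v≢0 _ ⟩
      X * s ⁻¹                                    ∎
      where
      regroup : ∀ v v′ s′ X → v * (v′ * s′ * X) ≡ X * s′ * (v * v′)
      regroup = solve 4 (λ v v′ s′ X → v :* (v′ :* s′ :* X) := X :* s′ :* (v :* v′)) refl

  τ-τ² : ∀ {X s} → s ≢ 0# → τ (v * s ⁻¹ , X * s ⁻¹) ≡ (X , s)
  τ-τ² {X} {s} s≢0 = cong₂ _,_ X₃≡ s₃≡
    where
    open ≡-Reasoning
    [v*s⁻¹]⁻¹≡ : (v * s ⁻¹) ⁻¹ ≡ v ⁻¹ * s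
    [v*s⁻¹]⁻¹≡ = trans (⁻¹-* v≢0 (⁻¹≢0 s≢0)) (cong (v ⁻¹ *_) (sym (⁻¹-unique (inverseˡ s s≢0))))
    X₃≡ : v * (X * s ⁻¹) * (v * s ⁻¹) ⁻¹ ≡ X
    X₃≡ = begin
      v * (X * s ⁻¹) * (v * s ⁻¹) ⁻¹             ≡⟨ cong (v * (X * s ⁻¹) *_) [v*s⁻¹]⁻¹≡ ⟩
      v * (X * s ⁻¹) * (v ⁻¹ * s)                ≡⟨ regroup v X (s ⁻¹) (v ⁻¹) s ⟩
      X * (v * v ⁻¹) * (s * s ⁻¹)                ≡⟨ trans (y*[x*x⁻¹]≡y s≢0 _) (y*[x*x⁻¹]≡y v≢0 _) ⟩
      X                                          ∎
      where
      regroup : ∀ v X s′ v′ s → v * (X * s′) * (v′ * s) ≡ X * (v * v′) * (s * s′)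
      regroup = solve 5 (λ v X s′ v′ s → v :* (X :* s′) :* (v′ :* s) := X :* (v :* v′) :* (s :* s′)) refl
    s₃≡ : v * (v * s ⁻¹) ⁻¹ ≡ s
    s₃≡ = begin
      v * (v * s ⁻¹) ⁻¹                          ≡⟨ cong (v *_) [v*s⁻¹]⁻¹≡ ⟩
      v * (v ⁻¹ * s)                             ≡⟨ regroup v (v ⁻¹) s ⟩
      s * (v * v ⁻¹)                             ≡⟨ y*[x*x⁻¹]≡y v≢0 s ⟩
      s                                          ∎
      where
      regroup : ∀ v v′ s → v * (v′ * s) ≡ s * (v * v′)
      regroup = solve 3 (λ v v′ s → v :* (v′ :* s) := s :* (v :* v′)) refl

  τ³≡id : ∀ {p} → OnChart p → τ (τ (τ p)) ≡ p
  τ³≡id A@(_ , _) = trans (cong τ (τ² A)) (τ-τ² (OnChart⇒s≢0 A))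

  τ-free : ∀ {p} → OnChart p → τ p ≢ p
  τ-free {X , s} A@(X≢0 , E′≡0) τp≡p = c≢1 c≡1
    where
    open ≡-Reasoning
    s≢0 = OnChart⇒s≢0 A
    X*s≡v : X * s ≡ v
    X*s≡v = ≡*⁻¹⇒*≡ X≢0 (sym (cong proj₂ τp≡p))
    X*X≡v*s : X * X ≡ v * s
    X*X≡v*s = ≡*⁻¹⇒*≡ X≢0 (sym (cong proj₁ τp≡p))
    X≡s : X ≡ s
    X≡s = x+y≡0⇒x≡y (x*y≡0⇒y≡0 X≢0 (begin
      X * (X + s)                                 ≡⟨ sym (factor X s) ⟩
      X * X + (s * s + s) * X + (X * s) * s       ≡⟨ cong (λ w → X * X + (s * s + s) * X + w * s) X*s≡v ⟩
      E′ X s                                      ≡⟨ E′≡0 ⟩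
      0#                                          ∎))
      where
      factor : ∀ X s → X * X + (s * s + s) * X + (X * s) * s ≡ X * (X + s)
      factor = solve 2 (λ X s → X :* X :+ (s :* s :+ s) :* X :+ (X :* s) :* s := X :* (X :+ s)) refl
    s≡1 : s ≡ 1#
    s≡1 = sym (*-cancelˡ s≢0 (*-cancelˡ s≢0 (begin
      s * (s * 1#)     ≡⟨ cong (s *_) (*-identityʳ s) ⟩
      s * s            ≡⟨ cong₂ _*_ (sym X≡s) (sym X≡s) ⟩
      X * X            ≡⟨ X*X≡v*s ⟩
      v * s            ≡⟨ cong (_* s) (sym X*s≡v) ⟩
      X * s * s        ≡⟨ cong (λ w → w * s * s) X≡s ⟩
      s * s * s        ≡⟨ *-assoc s s s ⟩
      s * (s * s)      ∎)))
    c*c≡1 : c * c ≡ 1#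
    c*c≡1 = trans (sym X*s≡v) (trans (cong₂ _*_ (trans X≡s s≡1) s≡1) (*-identityˡ 1#))
    c≡1 : c ≡ 1#
    c≡1 = x+y≡0⇒x≡y (x*x≡0⇒x≡0 (begin
      (c + 1#) * (c + 1#)   ≡⟨ [x+y]²≡x²+y² c 1# ⟩
      c * c + 1# * 1#       ≡⟨ cong₂ _+_ c*c≡1 (*-identityˡ 1#) ⟩
      1# + 1#               ≡⟨ 1+1≡0 ⟩
      0#                    ∎))

  3∣#OnChart : + 3 Signed.∣ Σ (λ X → Σ (λ s → 𝟙 (onChart? (X , s))))
  3∣#OnChart = subst (+ 3 Signed.∣_) (sum-pairs (𝟙 ∘ onChart?))
    (order-3-free-on⇒3∣count pairs τ onChart? τ³≡id τ-OnChart τ-free)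

  offAxis? : ∀ X Y → Dec (X ≢ 0# × OnCurve X Y)
  offAxis? X Y = ¬? (X ≟ 0#) ×-dec onCurve? X Y

  fibre-0 : fibre 0# ≡ + 2
  fibre-0 = begin
    fibre 0#                                   ≡⟨ Σ-cong (λ Y → 𝟙-⊎ (onCurve? 0# Y) (Y ≟ 0#) (Y ≟ v) (roots Y) (are-roots Y)
                                                                  (λ (Y≡0 , Y≡v) → v≢0 (trans (sym Y≡v) Y≡0))) ⟩
    Σ (λ Y → 𝟙 (Y ≟ 0#) +ℤ 𝟙 (Y ≟ v))          ≡⟨ Σ-+ (λ Y → 𝟙 (Y ≟ 0#)) (λ Y → 𝟙 (Y ≟ v)) ⟩
    Σ (λ Y → 𝟙 (Y ≟ 0#)) +ℤ Σ (λ Y → 𝟙 (Y ≟ v)) ≡⟨ cong₂ _+ℤ_ (Σ-δ 0#) (Σ-δ v) ⟩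
    + 2                                        ∎
    where
    open ≡-Reasoning
    on-0 : ∀ Y v → Y * Y + 0# * Y + v * Y + 0# * 0# * 0# ≡ Y * (Y + v)
    on-0 = solve 2 (λ Y v → Y :* Y :+ con false :* Y :+ v :* Y :+ con false :* con false :* con false := Y :* (Y :+ v)) refl
    roots : ∀ Y → OnCurve 0# Y → Y ≡ 0# ⊎ Y ≡ v
    roots Y on with Y ≟ 0#
    ... | yes Y≡0 = inj₁ Y≡0
    ... | no Y≢0 = inj₂ (x+y≡0⇒x≡y (x*y≡0⇒y≡0 Y≢0 (trans (sym (on-0 Y v)) (x≡y⇒x+y≡0 on))))
    are-roots : ∀ Y → Y ≡ 0# ⊎ Y ≡ v → OnCurve 0# Y
    are-roots Y Y≡0∨v = x+y≡0⇒x≡y (trans (on-0 Y v) (vanish Y≡0∨v))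
      where
      vanish : Y ≡ 0# ⊎ Y ≡ v → Y * (Y + v) ≡ 0#
      vanish (inj₁ refl) = zeroˡ _
      vanish (inj₂ refl) = trans (cong (v *_) (x+x≡0 v)) (zeroʳ v)

  offAxis-count : ∀ X → Σ (λ Y → 𝟙 (offAxis? X Y)) ≡ Σ (λ s → 𝟙 (onChart? (X , s)))
  offAxis-count X = by-cases (X ≟ 0#)
    where
    open ≡-Reasoning
    by-cases : Dec (X ≡ 0#) → Σ (λ Y → 𝟙 (offAxis? X Y)) ≡ Σ (λ s → 𝟙 (onChart? (X , s)))
    by-cases (yes refl) = trans (Σ-cong (λ Y → 𝟙-no (offAxis? 0# Y) (λ (0≢0 , _) → 0≢0 refl)))
                                (sym (Σ-cong (λ s → 𝟙-no (onChart? (0# , s)) (λ (0≢0 , _) → 0≢0 refl))))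
    by-cases (no X≢0) = begin
      Σ (λ Y → 𝟙 (offAxis? X Y))           ≡⟨ sym (Σ-reindex (*-↔ X≢0) (λ Y → 𝟙 (offAxis? X Y))) ⟩
      Σ (λ s → 𝟙 (offAxis? X (X * s)))     ≡⟨ Σ-cong (λ s → 𝟙-cong (λ (_ , on) → X≢0 , proj₁ (OnCurve⇔E′≡0 s X≢0) on)
                                                               (λ (_ , E′≡0) → X≢0 , proj₂ (OnCurve⇔E′≡0 s X≢0) E′≡0)
                                                               (offAxis? X (X * s)) (onChart? (X , s))) ⟩
      Σ (λ s → 𝟙 (onChart? (X , s)))        ∎

  split-off-axis : ∀ X Y → 𝟙 (onCurve? X Y) ≡ 𝟙 (X ≟ 0#) *ℤ 𝟙 (onCurve? X Y) +ℤ 𝟙 (offAxis? X Y)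
  split-off-axis X Y with X ≟ 0#
  ... | yes X≡0 = sym (trans (ℤP.+-identityʳ _) (ℤP.*-identityˡ _))
  ... | no X≢0 = trans (𝟙-cong (X≢0 ,_) proj₂ (onCurve? X Y) (yes X≢0 ×-dec onCurve? X Y)) (sym (ℤP.+-identityˡ _))

  Σfibre≡fibre-0+#OnChart : Σ fibre ≡ fibre 0# +ℤ Σ (λ X → Σ (λ s → 𝟙 (onChart? (X , s))))
  Σfibre≡fibre-0+#OnChart = begin
    Σ (λ X → Σ (λ Y → 𝟙 (onCurve? X Y)))
      ≡⟨ Σ-cong (λ X → trans (Σ-cong (split-off-axis X))
                             (Σ-+ (λ Y → 𝟙 (X ≟ 0#) *ℤ 𝟙 (onCurve? X Y)) (λ Y → 𝟙 (offAxis? X Y)))) ⟩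
    Σ (λ X → Σ (λ Y → 𝟙 (X ≟ 0#) *ℤ 𝟙 (onCurve? X Y)) +ℤ Σ (λ Y → 𝟙 (offAxis? X Y)))
      ≡⟨ Σ-+ (λ X → Σ (λ Y → 𝟙 (X ≟ 0#) *ℤ 𝟙 (onCurve? X Y))) (λ X → Σ (λ Y → 𝟙 (offAxis? X Y))) ⟩
    Σ (λ X → Σ (λ Y → 𝟙 (X ≟ 0#) *ℤ 𝟙 (onCurve? X Y))) +ℤ Σ (λ X → Σ (λ Y → 𝟙 (offAxis? X Y)))
      ≡⟨ cong₂ _+ℤ_ (trans (Σ-cong (λ X → Σ-scale (𝟙 (X ≟ 0#)) (𝟙 ∘ onCurve? X))) (Σ-pick 0# fibre)) (Σ-cong offAxis-count) ⟩
    fibre 0# +ℤ Σ (λ X → Σ (λ s → 𝟙 (onChart? (X , s))))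
      ∎
    where open ≡-Reasoning

  3∣q+χK-2 : + 3 Signed.∣ (+ q +ℤ χ c *ℤ K a) - + 2
  3∣q+χK-2 = subst (λ n → + 3 Signed.∣ n - + 2) count≡ (subst (+ 3 Signed.∣_) (sym 2+t-2≡t) 3∣#OnChart)
    where
    count≡ : + 2 +ℤ Σ (λ X → Σ (λ s → 𝟙 (onChart? (X , s)))) ≡ + q +ℤ χ c *ℤ K a
    count≡ = trans (cong (_+ℤ Σ (λ X → Σ (λ s → 𝟙 (onChart? (X , s))))) (sym fibre-0))
                   (trans (sym Σfibre≡fibre-0+#OnChart) Σfibre)
    2+t-2≡t : (+ 2 +ℤ Σ (λ X → Σ (λ s → 𝟙 (onChart? (X , s))))) - + 2 ≡ Σ (λ X → Σ (λ s → 𝟙 (onChart? (X , s))))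
    2+t-2≡t = 2+t-2≡t′ _
      where
      2+t-2≡t′ : ∀ t → (+ 2 +ℤ t) - + 2 ≡ t
      2+t-2≡t′ = solve-∀

-- The congruences

3∣2^n-[1+n%2] : ∀ n → + 3 Signed.∣ + (2 ℕ.^ n) - + (1 ℕ.+ n % 2)
3∣2^n-[1+n%2] zero = divides (+ 0) refl
3∣2^n-[1+n%2] (suc zero) = divides (+ 0) refl
3∣2^n-[1+n%2] (suc (suc n)) = subst (+ 3 Signed.∣_) (sym step)
  (∣m∣n⇒∣m+n (∣n⇒∣m*n (+ 4) (3∣2^n-[1+n%2] n)) (∣m⇒∣m*n (+ (1 ℕ.+ n % 2)) (Signed.∣-refl)))
  where
  r = 1 ℕ.+ n % 2
  [2+n]%2≡n%2 : suc (suc n) % 2 ≡ n % 2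
  [2+n]%2≡n%2 = trans (cong (_% 2) (ℕP.+-comm 2 n)) ([m+n]%n≡m%n n 2)
  step : + (2 ℕ.^ suc (suc n)) - + (1 ℕ.+ suc (suc n) % 2) ≡ + 4 *ℤ (+ (2 ℕ.^ n) - + r) +ℤ + 3 *ℤ + r
  step = trans (cong₂ _-_ (trans (ℤP.pos-* 2 (2 ℕ.^ suc n)) (cong (+ 2 *ℤ_) (ℤP.pos-* 2 (2 ℕ.^ n))))
                          (cong (λ k → + (1 ℕ.+ k)) [2+n]%2≡n%2))
               (regroup (+ (2 ℕ.^ n)) (+ r))
    where
    regroup : ∀ x r → + 2 *ℤ (+ 2 *ℤ x) - r ≡ + 4 *ℤ (x - r) +ℤ + 3 *ℤ r
    regroup = solve-∀

3∣K-s[2-r] : ∀ {Q K r s} → s *ℤ s ≡ + 1 →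
  + 3 Signed.∣ (Q +ℤ s *ℤ K) - + 2 → + 3 Signed.∣ Q - r → + 3 Signed.∣ K - s *ℤ (+ 2 - r)
3∣K-s[2-r] {Q} {K} {r} {s} s²≡1 3∣Q+sK-2 3∣Q-r =
  subst (+ 3 Signed.∣_) eq (∣n⇒∣m*n s (∣m∣n⇒∣m-n 3∣Q+sK-2 3∣Q-r))
  where
  regroup : ∀ Q K r s → s *ℤ (((Q +ℤ s *ℤ K) - + 2) - (Q - r)) ≡ (s *ℤ s) *ℤ K - s *ℤ (+ 2 - r)
  regroup = solve-∀
  eq : s *ℤ (((Q +ℤ s *ℤ K) - + 2) - (Q - r)) ≡ K - s *ℤ (+ 2 - r)
  eq = trans (regroup Q K r s) (trans (cong (λ t → t *ℤ K - s *ℤ (+ 2 - r)) s²≡1) (cong (_- s *ℤ (+ 2 - r)) (ℤP.*-identityˡ K)))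

theorem4 : (m : ℕ) → 2 < m → (F : FiniteField2^ m) →
    let open FiniteField2^ F in
    (c : Carrier) → c ≢ 0# → c ≢ 1# →
    ((m % 2 ≡ 0 → Tr c ≡ 0# → (+ 3) ∣ (K (c ^ 4 + c ^ 3) - + 1))
     × (m % 2 ≡ 0 → Tr c ≡ 1# → (+ 3) ∣ (K (c ^ 4 + c ^ 3) ℤ.+ + 1))
     × (m % 2 ≡ 1 → (+ 3) ∣ K (c ^ 4 + c ^ 3)))
theorem4 m _ F c c≢0 c≢1 = even∧Tr≡0 , even∧Tr≡1 , odd
  where
  open Field F
  open Curve F c c≢0 c≢1 using (a; 3∣q+χK-2)

  χ²≡1 : χ c *ℤ χ c ≡ + 1
  χ²≡1 with Tr∈𝔽₂ c
  ... | inj₁ Tr≡0 = cong (λ s → s *ℤ s) (χ-Tr≡0 Tr≡0)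
  ... | inj₂ Tr≡1 = cong (λ s → s *ℤ s) (χ-Tr≡1 Tr≡1)

  congruence : ∀ {s k} → χ c ≡ s → m % 2 ≡ k → + 3 Signed.∣ K a - s *ℤ (+ 2 - + (1 ℕ.+ k))
  congruence refl refl = 3∣K-s[2-r] {+ q} {K a} {+ (1 ℕ.+ m % 2)} {χ c} χ²≡1 3∣q+χK-2 (3∣2^n-[1+n%2] m)

  even∧Tr≡0 : m % 2 ≡ 0 → Tr c ≡ 0# → + 3 ∣ K a - + 1
  even∧Tr≡0 m-even Tr≡0 = ∣⇒∣ᵤ (congruence (χ-Tr≡0 Tr≡0) m-even)

  even∧Tr≡1 : m % 2 ≡ 0 → Tr c ≡ 1# → + 3 ∣ K a ℤ.+ + 1
  even∧Tr≡1 m-even Tr≡1 = ∣⇒∣ᵤ (congruence (χ-Tr≡1 Tr≡1) m-even)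

  odd : m % 2 ≡ 1 → + 3 ∣ K a
  odd m-odd with Tr∈𝔽₂ c
  ... | inj₁ Tr≡0 = ∣⇒∣ᵤ (subst (+ 3 Signed.∣_) (ℤP.+-identityʳ (K a)) (congruence (χ-Tr≡0 Tr≡0) m-odd))
  ... | inj₂ Tr≡1 = ∣⇒∣ᵤ (subst (+ 3 Signed.∣_) (ℤP.+-identityʳ (K a)) (congruence (χ-Tr≡1 Tr≡1) m-odd))
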